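{- The $B$-value of the white 3-clique in $\bigtriangleup_{d}$ that corresponds to $\tau=(r,s,t)\in\bigtriangleup_{d-2}$ (i.e. the white 3-clique with locations $(r,s+1,t+1),(r+1,s,t+1),(r+1,s+1,t)$) is \begin{equation*} \frac{\det(T[\mu+\alpha])\det(T[\mu+\beta])\det(T[\mu+\gamma])}{\det(T[\mu-\alpha])\det(T[\mu-\beta])\det(T[\mu-\gamma])}, \end{equation*} where $\mu=(r+1,s,t+1)$ and we interpret $\det(\emptyset)=1$.
   Context: Fix an integer $d\ge 2$, a field $\mathbb{F}$, and a vector space $V$ over $\mathbb{F}$ of dimension $d+1$. Let $\bigtriangleup_{d}=\{(r,s,t)\in\mathbb{N}^3 : r+s+t=d\}$ (locations). Two locations are adjacent if their difference lies in $\{\pm\alpha,\pm\beta,\pm\gamma\}$, where $\alpha=e_1-e_2$, $\beta=e_2-e_3$, $\gamma=e_3-e_1$ in $\mathbb{R}^3$. A black 3-clique is a set $\{(r+1,s,t),(r,s+1,t),(r,s,t+1)\}$ with $(r,s,t)\in\bigtriangleup_{d-1}$; a white 3-clique is a set $\{(r,s+1,t+1),(r+1,s,t+1),(r+1,s+1,t)\}$ with $(r,s,t)\in\bigtriangleup_{d-2}$. For a matrix $A\in{\rm Mat}_{d+1}(\mathbb{F})$ (rows/columns indexed $0,\dots,d$) and $0\le i\le j\le d$, let $A[i,j]$ denote the submatrix $\{A_{kl}\}_{0\le k\le j-i,\ i\le l\le j}$. Let $T\in{\rm Mat}_{d+1}(\mathbb{F})$ be upper triangular with $T[i,j]$ invertible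 for all $0\le i\le j\le d$ ("very good"). View $T$ as the transition matrix from a basis $\{u_i\}_{i=0}^d$ of $V$ to a basis $\{v_i\}_{i=0}^d$, i.e. $v_j=\sum_i T_{ij}u_i$. Define flags $U_i=\mathbb{F}u_0+\cdots+\mathbb{F}u_i$, $U'_i=\mathbb{F}u_d+\cdots+\mathbb{F}u_{d-i}$, $U''_i=\mathbb{F}v_d+\cdots+\mathbb{F}v_{d-i}$ $(0\le i\le d)$; they are totally opposite, and $B_\lambda=U_{d-r}\cap U'_{d-s}\cap U''_{d-t}$ for $\lambda=(r,s,t)\in\bigtriangleup_d$ defines a Billiard Array $B$ on $V$ (each $B_\lambda$ is 1-dimensional). For adjacent locations $\lambda,\lambda'$, let $\nu$ be the unique location such that $\lambda,\lambda',\nu$ form a black 3-clique, and define the linear bijection $\widetilde{B}_{\lambda,\lambda'}:B_\lambda\to B_{\lambda'}$ sending $x\mapsto y$ whenever $x\in B_\lambda$, $y\in B_{\lambda'}$ are nonzero with $x+y\in B_\nu$. For the white 3-clique corresponding to $\tau=(r,s,t)\in\bigtriangleup_{d-2}$, with $\mu=(r+1,s,t+1)$, its $B$-value (clockwise $B$-value) is the scalar $c$ such that $\widetilde{B}_{\mu+\beta,\mu-\alpha}\circ\widetilde{B}_{\mu,\mu+\beta}\circ\widetilde{B}_{\mu-\alpha,\mu}=c\cdot{\rm id}$ on $B_{\mu-\alpha}$ (here $\mu-\alpha=(r,s+1,t+1)$, $\mu+\beta=(r+1,s+1,t)$). For $\lambda=(r',s',t')\in\mathbb{Z}^3$, define $T[\lambda]=T[t',d-r']$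 if $\lambda\in\bigtriangleup_d$, and $T[\lambda]=\emptyset$ otherwise. -}

module Defs where

open import Level using (_⊔_)
open import Algebra.Bundles using (CommutativeRing)
open import Data.Nat as ℕ using (ℕ; zero; suc; _∸_; _<_; _≤_; _<?_)
open import Data.Fin as Fin using (Fin; toℕ; fromℕ<)
open import Data.Integer as ℤ using (ℤ; +_)
open import Data.Product using (Σ; ∃; _×_; _,_)
open import Relation.Nullary using (¬_; yes; no)

record Field (c ℓ : Level.Level) : Set (Level.suc (c ⊔ ℓ)) where
  field
    commutativeRing : CommutativeRing c ℓ
  open CommutativeRing commutativeRing public
  field
    1≉0     : ¬ (1# ≈ 0#)
    inverse : ∀ x → ¬ (x ≈ 0#) → Σ Carrier (λ y → x * y ≈ 1#)

Loc : Set
Loc = ℤ × ℤ × ℤ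

_+L_ : Loc → Loc → Loc
(a , b , c) +L (a' , b' , c') = (a ℤ.+ a' , b ℤ.+ b' , c ℤ.+ c')

_-L_ : Loc → Loc → Loc
(a , b , c) -L (a' , b' , c') = (a ℤ.- a' , b ℤ.- b' , c ℤ.- c')

α β γ : Loc
α = (+ 1 , ℤ.- (+ 1) , + 0)
β = (+ 0 , + 1 , ℤ.- (+ 1))
γ = (ℤ.- (+ 1) , + 0 , + 1)

-- Locations with natural-number coordinates (elements of △_d when r+s+t=d).
NLoc : Set
NLoc = ℕ × ℕ × ℕ

-- For two adjacent locations λ, λ' (two of the three vertices of a black
-- 3-clique {b+e₁, b+e₂, b+e₃}, where b is the componentwise minimum),
-- the third vertex ν = 3b + (1,1,1) - λ - λ'.
blackThird : NLoc → NLoc → NLoc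
blackThird (a , b , c) (a' , b' , c') =
  (3 ℕ.* ℕ._⊓_ a a' ℕ.+ 1 ∸ a ∸ a' ,
   3 ℕ.* ℕ._⊓_ b b' ℕ.+ 1 ∸ b ∸ b' ,
   3 ℕ.* ℕ._⊓_ c c' ℕ.+ 1 ∸ c ∸ c')

module WithField {c ℓ} (F : Field c ℓ) where
  open Field F

  ∑ : ∀ {n} → (Fin n → Carrier) → Carrier
  ∑ {zero}  f = 0#
  ∑ {suc n} f = f Fin.zero + ∑ (λ i → f (Fin.suc i))

  sgn : ℕ → Carrier
  sgn zero    = 1#
  sgn (suc k) = - sgn k

  Mat : ℕ → Set c
  Mat d = Fin (suc d) → Fin (suc d) → Carrier

  skip : ∀ {n} → Fin (suc n) → Fin n → Fin (suc n)
  skip = Fin.punchIn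

  det : ∀ n → (Fin n → Fin n → Carrier) → Carrier
  det zero    M = 1#
  det (suc n) M =
    ∑ (λ l → sgn (toℕ l) * (M Fin.zero l * det n (λ k l' → M (Fin.suc k) (skip l l'))))

  -- entry lookup with ℕ indices (0# out of range; only used in range)
  at : ∀ {d} → Mat d → ℕ → ℕ → Carrier
  at {d} T k l with k <? suc d | l <? suc d
  ... | yes k< | yes l< = T (fromℕ< k<) (fromℕ< l<)
  ... | _      | _      = 0#

  -- A[i,j] = { A_{kl} : 0 ≤ k ≤ j-i, i ≤ l ≤ j }, a (j-i+1)×(j-i+1) matrix
  sub : ∀ {d} → Mat d → (i j : ℕ) → Fin (suc (j ∸ i)) → Fin (suc (j ∸ i)) → Carrier
  sub T i j k l = at T (toℕ k) (i ℕ.+ toℕ l)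

  detSub : ∀ {d} → Mat d → ℕ → ℕ → Carrier
  detSub T i j = det (suc (j ∸ i)) (sub T i j)

  UpperTriangular : ∀ {d} → Mat d → Set ℓ
  UpperTriangular T = ∀ k l → toℕ l < toℕ k → T k l ≈ 0#

  VeryGood : ∀ {d} → Mat d → Set ℓ
  VeryGood {d} T = UpperTriangular T × (∀ i j → i ≤ j → j ≤ d → ¬ (detSub T i j ≈ 0#))

  -- det(T[λ]) where T[λ] = T[t', d - r'] for λ = (r',s',t') ∈ △_d and
  -- T[λ] = ∅ otherwise, with det(∅) = 1
  detT : ∀ {d} → Mat d → Loc → Carrier
  detT {d} T (r' , s' , t') with ℤ.0ℤ ℤ.≤? r' | ℤ.0ℤ ℤ.≤? s' | ℤ.0ℤ ℤ.≤? t' | r' ℤ.+ s' ℤ.+ t' ℤ.≟ + d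
  ... | yes _ | yes _ | yes _ | yes _ = detSub T ℤ.∣ t' ∣ (d ∸ ℤ.∣ r' ∣)
  ... | _     | _     | _     | _     = 1#

  -- The vector space V is modelled as F^(d+1), the basis {u_i} being the
  -- standard basis; v_j = Σ_i T_ij u_i.

  Vec : ℕ → Set c
  Vec d = Fin (suc d) → Carrier

  _≈V_ : ∀ {d} → Vec d → Vec d → Set ℓ
  x ≈V y = ∀ k → x k ≈ y k

  _+V_ : ∀ {d} → Vec d → Vec d → Vec d
  (x +V y) k = x k + y k

  _·V_ : ∀ {d} → Carrier → Vec d → Vec d
  (a ·V x) k = a * x k

  0V : ∀ {d} → Vec d
  0V k = 0#

  NonZero : ∀ {d} → Vec d → Set ℓ
  NonZero x = ¬ (x ≈V 0V)

  -- x ∈ U_i = span{u_0,…,u_i}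
  InU : ∀ {d} → ℕ → Vec d → Set ℓ
  InU i x = ∀ k → i < toℕ k → x k ≈ 0#

  -- x ∈ U'_i = span{u_d,…,u_{d-i}}
  InU' : ∀ {d} → ℕ → Vec d → Set ℓ
  InU' {d} i x = ∀ k → toℕ k < d ∸ i → x k ≈ 0#

  -- x ∈ U''_i = span{v_d,…,v_{d-i}}, where v_j = Σ_k T_kj u_k
  InU'' : ∀ {d} → Mat d → ℕ → Vec d → Set (c ⊔ ℓ)
  InU'' {d} T i x =
    Σ (Vec d) λ a → (∀ j → toℕ j < d ∸ i → a j ≈ 0#)
                  × (∀ k → x k ≈ ∑ (λ j → T k j * a j))

  -- B_λ = U_{d-r} ∩ U'_{d-s} ∩ U''_{d-t}, λ = (r,s,t)
  InB : ∀ {d} → Mat d → NLoc → Vec d → Set (c ⊔ ℓ)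
  InB {d} T (r , s , t) x = InU (d ∸ r) x × InU' (d ∸ s) x × InU'' T (d ∸ t) x

  -- graph of B̃_{λ,λ'} : B_λ → B_λ' : x ↦ y iff x ∈ B_λ, y ∈ B_λ' nonzero
  -- and x + y ∈ B_ν, ν the third vertex of the black 3-clique
  Btilde : ∀ {d} → Mat d → NLoc → NLoc → Vec d → Vec d → Set (c ⊔ ℓ)
  Btilde T p q x y =
    InB T p x × NonZero x × InB T q y × NonZero y × InB T (blackThird p q) (x +V y)

  -- c is the (clockwise) B-value of the white 3-clique for τ = (r,s,t):
  -- B̃_{μ+β,μ-α} ∘ B̃_{μ,μ+β} ∘ B̃_{μ-α,μ} = c · id on B_{μ-α},
  -- where μ-α = (r,s+1,t+1), μ = (r+1,s,t+1), μ+β = (r+1,s+1,t).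
  IsBValue : ∀ {d} → Mat d → ℕ → ℕ → ℕ → Carrier → Set (c ⊔ ℓ)
  IsBValue {d} T r s t c₀ =
    ∀ (x y z w : Vec d) →
      Btilde T μ-α μ x y → Btilde T μ μ+β y z → Btilde T μ+β μ-α z w →
      w ≈V (c₀ ·V x)
    where
      μ-α μ μ+β : NLoc
      μ-α = (r , suc s , suc t)
      μ   = (suc r , s , suc t)
      μ+β = (suc r , suc s , t)

-- With V = F^{d+1} and uᵢ the standard basis, every B_λ, λ = (r,s,t)
-- ∈ △_d, contains an explicit "canonical vector" T·a whose coordinates are
-- bordered minors of T, and B_λ = 0 whenever the coordinates of λ sum to d+1;
-- so B_λ is the line of its canonical vector and the maps B̃ are determined.
-- On each edge λ → λ' of the white clique, with black third vertex ν, the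
-- canonical vectors P, Q satisfy P + κQ ∈ B_ν for κ the (signed) ratio of two
-- of the six determinants, forced by one coordinate that must vanish; hence
-- B̃_{λ,λ'} multiplies by κ, and the B-value is the product of the ratios.
module Submission where

open import Defs
open import Level using (_⊔_)
open import Data.Nat as ℕ using (ℕ; zero; suc; _∸_; _≤_; _<_; z≤n; s≤s; _<?_)
  renaming (_+_ to _+ₙ_)
import Data.Nat.Properties as ℕP
open import Data.Nat.Tactic.RingSolver using (solve-∀)
open import Data.Fin as Fin using (Fin; toℕ; fromℕ<; punchIn; punchOut)
import Data.Fin.Properties as FinP
import Data.Integer as ℤ
open import Data.Product using (Σ; proj₁; proj₂; _,_; _×_)
open import Data.Empty using (⊥-elim)
open import Relation.Nullary using (yes; no; ¬_)
open import Relation.Binary.PropositionalEquality as ≡ using (_≡_; _≢_; cong; cong₂)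
open import Function.Base using (_∘_)
open import Function.Bundles using (_⇔_; mk⇔)

-- `blackThird` computes each coordinate as 3·min(a,a') + 1 ∸ a ∸ a'.  On the
-- two vertices b + eᵢ, b + eⱼ of a black 3-clique this is the coordinate of
-- the third vertex b + eₖ: the base coordinate where the two vertices differ,
-- one more than it where they agree.
third-coord : ∀ {a a' m} x → a ℕ.⊓ a' ≡ m → 3 ℕ.* m +ₙ 1 ≡ x +ₙ (a +ₙ a') → 3 ℕ.* (a ℕ.⊓ a') +ₙ 1 ∸ a ∸ a' ≡ x
third-coord {a} {a'} {m} x min≡m split = begin
  3 ℕ.* (a ℕ.⊓ a') +ₙ 1 ∸ a ∸ a'  ≡⟨ cong (λ k → 3 ℕ.* k +ₙ 1 ∸ a ∸ a') min≡m ⟩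
  3 ℕ.* m +ₙ 1 ∸ a ∸ a'           ≡⟨ cong (λ k → k ∸ a ∸ a') split ⟩
  x +ₙ (a +ₙ a') ∸ a ∸ a'          ≡⟨ ℕP.∸-+-assoc (x +ₙ (a +ₙ a')) a a' ⟩
  x +ₙ (a +ₙ a') ∸ (a +ₙ a')        ≡⟨ ℕP.m+n∸n≡m x (a +ₙ a') ⟩
  x                               ∎
  where open ≡.≡-Reasoning

third-coord-< : ∀ a → 3 ℕ.* (a ℕ.⊓ suc a) +ₙ 1 ∸ a ∸ suc a ≡ a
third-coord-< a = third-coord a (ℕP.m≤n⇒m⊓n≡m (ℕP.n≤1+n a)) (split a)
  where
  split : ∀ a → 3 ℕ.* a +ₙ 1 ≡ a +ₙ (a +ₙ suc a)
  split = solve-∀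

third-coord-> : ∀ a → 3 ℕ.* (suc a ℕ.⊓ a) +ₙ 1 ∸ suc a ∸ a ≡ a
third-coord-> a = third-coord a (ℕP.m≥n⇒m⊓n≡n (ℕP.n≤1+n a)) (split a)
  where
  split : ∀ a → 3 ℕ.* a +ₙ 1 ≡ a +ₙ (suc a +ₙ a)
  split = solve-∀

third-coord-≡ : ∀ a → 3 ℕ.* (a ℕ.⊓ a) +ₙ 1 ∸ a ∸ a ≡ suc a
third-coord-≡ a = third-coord (suc a) (ℕP.⊓-idem a) (split a)
  where
  split : ∀ a → 3 ℕ.* a +ₙ 1 ≡ suc a +ₙ (a +ₙ a)
  split = solve-∀

third[μ-α,μ] : ∀ r s t → blackThird (r , suc s , suc t) (suc r , s , suc t) ≡ (r , s , suc (suc t))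
third[μ-α,μ] r s t = cong₂ _,_ (third-coord-< r) (cong₂ _,_ (third-coord-> s) (third-coord-≡ (suc t)))

third[μ,μ+β] : ∀ r s t → blackThird (suc r , s , suc t) (suc r , suc s , t) ≡ (suc (suc r) , s , t)
third[μ,μ+β] r s t = cong₂ _,_ (third-coord-≡ (suc r)) (cong₂ _,_ (third-coord-< s) (third-coord-> t))

third[μ+β,μ-α] : ∀ r s t → blackThird (suc r , suc s , t) (r , suc s , suc t) ≡ (r , suc (suc s) , t)
third[μ+β,μ-α] r s t = cong₂ _,_ (third-coord-> r) (cong₂ _,_ (third-coord-≡ (suc s)) (third-coord-< t))

module Coordinates {r s t n : ℕ} (sum : r +ₙ s +ₙ t ≡ n) where
  r≤n : r ≤ n
  r≤n = ≡.subst (r ≤_) sum (ℕP.≤-trans (ℕP.m≤m+n r s) (ℕP.m≤m+n (r +ₙ s) t))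

  s≤n : s ≤ n
  s≤n = ≡.subst (s ≤_) sum (ℕP.≤-trans (ℕP.m≤n+m s r) (ℕP.m≤m+n (r +ₙ s) t))

  t≤n : t ≤ n
  t≤n = ≡.subst (t ≤_) sum (ℕP.m≤n+m t (r +ₙ s))

  n∸r : n ∸ r ≡ t +ₙ s
  n∸r = begin
    n ∸ r              ≡⟨ cong (_∸ r) (≡.sym sum) ⟩
    r +ₙ s +ₙ t ∸ r     ≡⟨ cong (_∸ r) (ℕP.+-assoc r s t) ⟩
    r +ₙ (s +ₙ t) ∸ r   ≡⟨ ℕP.m+n∸m≡n r (s +ₙ t) ⟩
    s +ₙ t             ≡⟨ ℕP.+-comm s t ⟩
    t +ₙ s             ∎
    where open ≡.≡-Reasoning

  window≤ : t +ₙ suc s ≤ suc n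
  window≤ = ≡.subst (_≤ suc n) (≡.sym (ℕP.+-suc t s)) (s≤s (≡.subst (_≤ n) n∸r (ℕP.m∸n≤m n r)))

module CliqueArithmetic (r s t : ℕ) where
  open import Data.List using (_∷_; [])
  open import Data.Nat.Tactic.RingSolver using (solve)

  in△[μ-α] : r +ₙ suc s +ₙ suc t ≡ r +ₙ s +ₙ t +ₙ 2
  in△[μ-α] = solve (r ∷ s ∷ t ∷ [])
  in△[μ] : suc r +ₙ s +ₙ suc t ≡ r +ₙ s +ₙ t +ₙ 2
  in△[μ] = solve (r ∷ s ∷ t ∷ [])
  in△[μ+β] : suc r +ₙ suc s +ₙ t ≡ r +ₙ s +ₙ t +ₙ 2
  in△[μ+β] = solve (r ∷ s ∷ t ∷ [])
  in△[ν₁] : r +ₙ s +ₙ suc (suc t) ≡ r +ₙ s +ₙ t +ₙ 2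
  in△[ν₁] = solve (r ∷ s ∷ t ∷ [])
  in△[ν₂] : suc (suc r) +ₙ s +ₙ t ≡ r +ₙ s +ₙ t +ₙ 2
  in△[ν₂] = solve (r ∷ s ∷ t ∷ [])
  in△[ν₃] : r +ₙ suc (suc s) +ₙ t ≡ r +ₙ s +ₙ t +ₙ 2
  in△[ν₃] = solve (r ∷ s ∷ t ∷ [])

  -- The locations carrying B_to ∩ B_ν for the three edges.
  sum[meet₁] : suc r +ₙ s +ₙ suc (suc t) ≡ suc (r +ₙ s +ₙ t +ₙ 2)
  sum[meet₁] = solve (r ∷ s ∷ t ∷ [])
  sum[meet₂] : suc (suc r) +ₙ suc s +ₙ t ≡ suc (r +ₙ s +ₙ t +ₙ 2)
  sum[meet₂] = solve (r ∷ s ∷ t ∷ [])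
  sum[meet₃] : r +ₙ suc (suc s) +ₙ suc t ≡ suc (r +ₙ s +ₙ t +ₙ 2)
  sum[meet₃] = solve (r ∷ s ∷ t ∷ [])

  -- The neighbours μ ± α, β, γ, written as (a, b-1, c) with a+b+c = d+1,
  -- in the form in which `_+L_`, `_-L_` compute them.
  sum[μ+α] : (suc r +ₙ 1) +ₙ s +ₙ (suc t +ₙ 0) ≡ suc (r +ₙ s +ₙ t +ₙ 2)
  sum[μ+α] = solve (r ∷ s ∷ t ∷ [])
  sum[μ+β] : (suc r +ₙ 0) +ₙ suc (s +ₙ 1) +ₙ t ≡ suc (r +ₙ s +ₙ t +ₙ 2)
  sum[μ+β] = solve (r ∷ s ∷ t ∷ [])
  sum[μ+γ] : r +ₙ suc (s +ₙ 0) +ₙ (suc t +ₙ 1) ≡ suc (r +ₙ s +ₙ t +ₙ 2)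
  sum[μ+γ] = solve (r ∷ s ∷ t ∷ [])
  sum[μ-α] : r +ₙ suc (s +ₙ 1) +ₙ (suc t +ₙ 0) ≡ suc (r +ₙ s +ₙ t +ₙ 2)
  sum[μ-α] = solve (r ∷ s ∷ t ∷ [])
  sum[μ-β] : (suc r +ₙ 0) +ₙ s +ₙ (suc t +ₙ 1) ≡ suc (r +ₙ s +ₙ t +ₙ 2)
  sum[μ-β] = solve (r ∷ s ∷ t ∷ [])
  sum[μ-γ] : (suc r +ₙ 1) +ₙ suc (s +ₙ 0) +ₙ t ≡ suc (r +ₙ s +ₙ t +ₙ 2)
  sum[μ-γ] = solve (r ∷ s ∷ t ∷ [])

module FieldFacts {c ℓ} (F : Field c ℓ) where
  open Field F hiding (zero)
  open WithField F
  open import Relation.Binary.Reasoning.Setoid setoid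
  open import Algebra.Properties.Ring ring using (-‿distribˡ-*; -‿distribʳ-*; -‿involutive; -0#≈0#; -1*x≈-x)
  open import Algebra.Properties.AbelianGroup +-abelianGroup using (⁻¹-∙-comm)
  open import Algebra.Properties.Semiring.Sum semiring
    using (sum; sum-cong-≋; sum-cong-≗; sum-replicate-zero; sum-remove; ∑-distrib-+; ∑-comm; *-distribˡ-sum; *-distribʳ-sum)
  open import Algebra.Solver.Ring.NaturalCoefficients.Default commutativeSemiring using (solve; _:=_; _:+_; _:*_)

  R : Set c
  R = Carrier

  neg-*ˡ : ∀ x y → (- x) * y ≈ - (x * y)
  neg-*ˡ x y = sym (-‿distribˡ-* x y)

  neg-*ʳ : ∀ x y → x * (- y) ≈ - (x * y)
  neg-*ʳ x y = sym (-‿distribʳ-* x y)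

  neg-+ : ∀ x y → - (x + y) ≈ - x + - y
  neg-+ x y = sym (⁻¹-∙-comm x y)

  neg-swap : ∀ x y z → x * ((- y) * z) ≈ (- x) * (y * z)
  neg-swap x y z = trans (*-congˡ (neg-*ˡ y z)) (trans (neg-*ʳ x _) (sym (neg-*ˡ x _)))

  *≈0ʳ : ∀ x {y} → y ≈ 0# → x * y ≈ 0#
  *≈0ʳ x y≈0 = trans (*-congˡ y≈0) (zeroʳ x)

  *≈0ˡ : ∀ {x} y → x ≈ 0# → x * y ≈ 0#
  *≈0ˡ y x≈0 = trans (*-congʳ x≈0) (zeroˡ y)

  sgn-sq : ∀ k → sgn k * sgn k ≈ 1#
  sgn-sq zero    = *-identityˡ 1#
  sgn-sq (suc k) = trans (neg-*ˡ _ _) (trans (-‿cong (neg-*ʳ _ _)) (trans (-‿involutive _) (sgn-sq k)))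

  inv : ∀ x → ¬ (x ≈ 0#) → R
  inv x x≉0 = proj₁ (inverse x x≉0)

  inv-r : ∀ x (x≉0 : ¬ (x ≈ 0#)) → x * inv x x≉0 ≈ 1#
  inv-r x x≉0 = proj₂ (inverse x x≉0)

  *-inv-cancel : ∀ y x (x≉0 : ¬ (x ≈ 0#)) → (y * x) * inv x x≉0 ≈ y
  *-inv-cancel y x x≉0 = trans (*-assoc _ _ _) (trans (*-congˡ (inv-r x x≉0)) (*-identityʳ y))

  quot : ∀ x y → ¬ (y ≈ 0#) → R
  quot x y y≉0 = x * inv y y≉0

  quot-* : ∀ x y (y≉0 : ¬ (y ≈ 0#)) → quot x y y≉0 * y ≈ x
  quot-* x y y≉0 = trans (*-assoc _ _ _) (trans (*-congˡ (trans (*-comm _ _) (inv-r y y≉0))) (*-identityʳ x))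

  cancelˡ : ∀ a x → ¬ (a ≈ 0#) → a * x ≈ 0# → x ≈ 0#
  cancelˡ a x a≉0 ax≈0 = begin
    x                  ≈⟨ sym (*-identityˡ x) ⟩
    1# * x             ≈⟨ *-congʳ (sym (inv-r a a≉0)) ⟩
    (a * inv a a≉0) * x ≈⟨ solve 3 (λ a b x → ((a :* b) :* x) := (b :* (a :* x))) refl a (inv a a≉0) x ⟩
    inv a a≉0 * (a * x) ≈⟨ *≈0ʳ _ ax≈0 ⟩
    0#                 ∎

  cancelʳ : ∀ a b x → ¬ (x ≈ 0#) → a * x ≈ b * x → a ≈ b
  cancelʳ a b x x≉0 e = begin
    a                    ≈⟨ sym (*-inv-cancel a x x≉0) ⟩
    (a * x) * inv x x≉0  ≈⟨ *-congʳ e ⟩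
    (b * x) * inv x x≉0  ≈⟨ *-inv-cancel b x x≉0 ⟩
    b                    ∎

  *-nonzero : ∀ {x y} → ¬ (x ≈ 0#) → ¬ (y ≈ 0#) → ¬ (x * y ≈ 0#)
  *-nonzero {x} {y} x≉0 y≉0 xy≈0 = y≉0 (cancelˡ x y x≉0 xy≈0)

  neg-nonzero : ∀ {x} → ¬ (x ≈ 0#) → ¬ (- x ≈ 0#)
  neg-nonzero {x} x≉0 -x≈0 = x≉0 (trans (sym (-‿involutive x)) (trans (-‿cong -x≈0) -0#≈0#))

  quot-nonzero : ∀ {x y} (y≉0 : ¬ (y ≈ 0#)) → ¬ (x ≈ 0#) → ¬ (quot x y y≉0 ≈ 0#)
  quot-nonzero {x} {y} y≉0 x≉0 q≈0 = x≉0 (trans (sym (quot-* x y y≉0)) (*≈0ˡ y q≈0))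

  difference≈0 : ∀ a κ b → a + (- κ) * b ≈ 0# → a ≈ κ * b
  difference≈0 a κ b a-κb≈0 = begin
    a                             ≈⟨ sym (+-identityʳ a) ⟩
    a + 0#                        ≈⟨ +-congˡ (sym (-‿inverseˡ (κ * b))) ⟩
    a + (- (κ * b) + κ * b)       ≈⟨ sym (+-assoc _ _ _) ⟩
    (a + - (κ * b)) + κ * b       ≈⟨ +-congʳ (trans (+-congˡ (sym (neg-*ˡ κ b))) a-κb≈0) ⟩
    0# + κ * b                    ≈⟨ +-identityˡ _ ⟩
    κ * b                         ∎

  shift-combination : ∀ κ P y c Q x → x ≈ κ * P → (x + y) + (- κ) * (P + c * Q) ≈ y + (- (κ * c)) * Q
  shift-combination κ P y c Q x x≈κP = begin
    (x + y) + (- κ) * (P + c * Q)                 ≈⟨ +-cong (+-congʳ x≈κP) (trans (neg-*ˡ _ _) (trans (-‿cong (distribˡ _ _ _)) (neg-+ _ _))) ⟩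
    (κ * P + y) + (- (κ * P) + - (κ * (c * Q)))   ≈⟨ solve 4 (λ a y na nb → ((a :+ y) :+ (na :+ nb)) := ((a :+ na) :+ (y :+ nb))) refl (κ * P) y (- (κ * P)) (- (κ * (c * Q))) ⟩
    (κ * P + - (κ * P)) + (y + - (κ * (c * Q)))   ≈⟨ +-congʳ (-‿inverseʳ _) ⟩
    0# + (y + - (κ * (c * Q)))                    ≈⟨ +-identityˡ _ ⟩
    y + - (κ * (c * Q))                           ≈⟨ +-congˡ (trans (-‿cong (sym (*-assoc _ _ _))) (sym (neg-*ˡ _ _))) ⟩
    y + (- (κ * c)) * Q                           ∎

  ratio-cancel : ∀ m x y (y≉0 : ¬ (y ≈ 0#)) → m * x + (- quot x y y≉0) * (m * y) ≈ 0#
  ratio-cancel m x y y≉0 = begin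
    m * x + (- quot x y y≉0) * (m * y)   ≈⟨ +-congˡ (trans (neg-*ˡ _ _) (-‿cong (reorder (x * inv y y≉0) m y))) ⟩
    m * x + - (m * (quot x y y≉0 * y))   ≈⟨ +-congˡ (-‿cong (*-congˡ (quot-* x y y≉0))) ⟩
    m * x + - (m * x)                    ≈⟨ -‿inverseʳ _ ⟩
    0#                                   ∎
    where
    reorder : ∀ q m y → q * (m * y) ≈ m * (q * y)
    reorder = solve 3 (λ q m y → (q :* (m :* y)) := (m :* (q :* y))) refl

  ∑≡sum : ∀ {n} (f : Fin n → R) → ∑ f ≡ sum f
  ∑≡sum {zero}  f = ≡.refl
  ∑≡sum {suc n} f = cong (f Fin.zero +_) (∑≡sum (f ∘ Fin.suc))

  via-sum : ∀ {m n} {f : Fin m → R} {g : Fin n → R} → sum f ≈ sum g → ∑ f ≈ ∑ g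
  via-sum {f = f} {g} e = trans (reflexive (∑≡sum f)) (trans e (reflexive (≡.sym (∑≡sum g))))

  ∑-cong : ∀ {n} (f g : Fin n → R) → (∀ i → f i ≈ g i) → ∑ f ≈ ∑ g
  ∑-cong f g f≈g = via-sum {f = f} {g = g} (sum-cong-≋ f≈g)

  ∑-zero : ∀ {n} (f : Fin n → R) → (∀ i → f i ≈ 0#) → ∑ f ≈ 0#
  ∑-zero {n} f f≈0 = trans (∑-cong f (λ _ → 0#) f≈0) (trans (reflexive (∑≡sum {n} (λ _ → 0#))) (sum-replicate-zero n))

  ∑-+ : ∀ {n} (f g : Fin n → R) → ∑ (λ i → f i + g i) ≈ ∑ f + ∑ g
  ∑-+ f g = trans (reflexive (∑≡sum (λ i → f i + g i))) (trans (∑-distrib-+ f g)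
                  (sym (+-cong (reflexive (∑≡sum f)) (reflexive (∑≡sum g)))))

  ∑-*ˡ : ∀ {n} x (f : Fin n → R) → x * ∑ f ≈ ∑ (λ i → x * f i)
  ∑-*ˡ x f = trans (*-congˡ (reflexive (∑≡sum f))) (trans (*-distribˡ-sum x f) (reflexive (≡.sym (∑≡sum (λ i → x * f i)))))

  ∑-*ʳ : ∀ {n} x (f : Fin n → R) → ∑ f * x ≈ ∑ (λ i → f i * x)
  ∑-*ʳ x f = trans (*-congʳ (reflexive (∑≡sum f))) (trans (*-distribʳ-sum x f) (reflexive (≡.sym (∑≡sum (λ i → f i * x)))))

  ∑-neg : ∀ {n} (f : Fin n → R) → - ∑ f ≈ ∑ (λ i → - f i)
  ∑-neg f = trans (sym (-1*x≈-x _)) (trans (∑-*ˡ (- 1#) f) (∑-cong _ (λ i → - f i) (λ i → -1*x≈-x (f i))))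

  ∑-swap : ∀ {m n} (f : Fin m → Fin n → R) → ∑ (λ i → ∑ (f i)) ≈ ∑ (λ j → ∑ (λ i → f i j))
  ∑-swap f = trans (reflexive (double f)) (trans (∑-comm f) (reflexive (≡.sym (double (λ j i → f i j)))))
    where
    double : ∀ {m n} (g : Fin m → Fin n → R) → ∑ (λ i → ∑ (g i)) ≡ sum (λ i → sum (g i))
    double g = ≡.trans (∑≡sum (λ i → ∑ (g i))) (sum-cong-≗ (λ i → ∑≡sum (g i)))

  ∑-single : ∀ {n} (f : Fin n → R) (i : Fin n) → (∀ j → j ≢ i → f j ≈ 0#) → ∑ f ≈ f i
  ∑-single {suc n} f i others≈0 = begin
    ∑ f                                ≈⟨ reflexive (∑≡sum f) ⟩
    sum f                              ≈⟨ sum-remove f ⟩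
    f i + sum (λ j → f (punchIn i j))  ≈⟨ +-congˡ (trans (sum-cong-≋ (λ j → others≈0 _ (FinP.punchInᵢ≢i i j))) (sum-replicate-zero n)) ⟩
    f i + 0#                           ≈⟨ +-identityʳ (f i) ⟩
    f i                                ∎

  Σ< : ℕ → (ℕ → R) → R
  Σ< n g = ∑ {n} (λ j → g (toℕ j))

  Σ<-cong : ∀ n (f g : ℕ → R) → (∀ j → j < n → f j ≈ g j) → Σ< n f ≈ Σ< n g
  Σ<-cong n f g f≈g = ∑-cong (λ j → f (toℕ j)) (λ j → g (toℕ j)) (λ j → f≈g (toℕ j) (FinP.toℕ<n j))

  Σ<-zero : ∀ n (f : ℕ → R) → (∀ j → j < n → f j ≈ 0#) → Σ< n f ≈ 0#
  Σ<-zero n f f≈0 = ∑-zero _ (λ j → f≈0 (toℕ j) (FinP.toℕ<n j))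

  Σ<-single : ∀ n (f : ℕ → R) j → j < n → (∀ i → i < n → i ≢ j → f i ≈ 0#) → Σ< n f ≈ f j
  Σ<-single n f j j<n others≈0 =
    trans (∑-single _ (fromℕ< j<n) (λ i i≢j → others≈0 (toℕ i) (FinP.toℕ<n i)
                          (λ e → i≢j (FinP.toℕ-injective (≡.trans e (≡.sym (FinP.toℕ-fromℕ< j<n)))))))
          (reflexive (cong f (FinP.toℕ-fromℕ< j<n)))

  Σ<-window : ∀ t m n (f : ℕ → R) → t +ₙ m ≤ n → (∀ j → j < t → f j ≈ 0#) → (∀ j → t +ₙ m ≤ j → f j ≈ 0#) →
              Σ< n f ≈ Σ< m (λ l → f (t +ₙ l))
  Σ<-window zero    zero    n       f _         _     above = Σ<-zero n f (λ j _ → above j z≤n)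
  Σ<-window zero    (suc m) (suc n) f (s≤s le) _     above =
    +-congˡ (Σ<-window zero m n (f ∘ suc) le (λ _ ()) (λ j le' → above (suc j) (s≤s le')))
  Σ<-window (suc t) m       (suc n) f (s≤s le) below above =
    trans (+-cong (below 0 (s≤s z≤n)) (Σ<-window t m n (f ∘ suc) le (λ j lt → below (suc j) (s≤s lt)) (λ j le' → above (suc j) (s≤s le'))))
          (+-identityˡ _)

  zeroExtend : ∀ {m} → (Fin m → R) → ℕ → R
  zeroExtend {zero}  f j       = 0#
  zeroExtend {suc m} f zero    = f Fin.zero
  zeroExtend {suc m} f (suc j) = zeroExtend (f ∘ Fin.suc) j

  zeroExtend-toℕ : ∀ {m} (f : Fin m → R) (i : Fin m) → zeroExtend f (toℕ i) ≡ f i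
  zeroExtend-toℕ {suc m} f Fin.zero    = ≡.refl
  zeroExtend-toℕ {suc m} f (Fin.suc i) = zeroExtend-toℕ (f ∘ Fin.suc) i

  zeroExtend-fromℕ< : ∀ {m} (f : Fin m → R) j (j<m : j < m) → zeroExtend f j ≡ f (fromℕ< j<m)
  zeroExtend-fromℕ< f j j<m = ≡.trans (cong (zeroExtend f) (≡.sym (FinP.toℕ-fromℕ< j<m))) (zeroExtend-toℕ f (fromℕ< j<m))

  zeroExtend-beyond : ∀ {m} (f : Fin m → R) j → m ≤ j → zeroExtend f j ≡ 0#
  zeroExtend-beyond {zero}  f j       _        = ≡.refl
  zeroExtend-beyond {suc m} f (suc j) (s≤s le) = zeroExtend-beyond (f ∘ Fin.suc) j le

  Σ<-zeroExtend : ∀ m (g : ℕ → R) (f : Fin m → R) → Σ< m (λ l → g l * zeroExtend f l) ≈ ∑ (λ l → g (toℕ l) * f l)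
  Σ<-zeroExtend m g f = ∑-cong _ (λ l → g (toℕ l) * f l) (λ l → *-congˡ (reflexive (zeroExtend-toℕ f l)))

  delay : ℕ → (ℕ → R) → ℕ → R
  delay zero    g j       = g j
  delay (suc t) g zero    = 0#
  delay (suc t) g (suc j) = delay t g j

  delay-below : ∀ t g j → j < t → delay t g j ≡ 0#
  delay-below (suc t) g zero    _        = ≡.refl
  delay-below (suc t) g (suc j) (s≤s lt) = delay-below t g j lt

  delay-at : ∀ t g l → delay t g (t +ₙ l) ≡ g l
  delay-at zero    g l = ≡.refl
  delay-at (suc t) g l = delay-at t g l

  delay-from : ∀ t g j → t ≤ j → delay t g j ≡ g (j ∸ t)
  delay-from zero    g j       _        = ≡.refl
  delay-from (suc t) g (suc j) (s≤s le) = delay-from t g j le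

-- From expansion along the
-- first column we get invariance under transposition; the sign rule for
-- moving a column to the front and vanishing on two equal columns follow by
-- induction, linearity in a column by expanding along it.  Together these
-- give the one fact about determinants the Billiard Array needs: a square
-- matrix with nonzero determinant has trivial kernel.
module Determinants {c ℓ} (F : Field c ℓ) where
  open Field F hiding (zero)
  open WithField F
  open FieldFacts F
  open import Relation.Binary.Reasoning.Setoid setoid
  open import Algebra.Properties.Ring ring using (-‿involutive; -0#≈0#)
  open import Algebra.Solver.Ring.NaturalCoefficients.Default commutativeSemiring using (solve; _:=_; _:+_; _:*_)

  Matrix : ℕ → Set c
  Matrix n = Fin n → Fin n → R

  transpose : ∀ {n} → Matrix n → Matrix n
  transpose M i j = M j i

  rowMinor colMinor : ∀ {n} → Matrix (suc n) → Fin (suc n) → Matrix n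
  rowMinor M l k l' = M (Fin.suc k) (punchIn l l')
  colMinor M k k' l' = M (punchIn k k') (Fin.suc l')

  rowTerm colTerm : ∀ {n} → Matrix (suc n) → Fin (suc n) → R
  rowTerm {n} M l = sgn (toℕ l) * (M Fin.zero l * det n (rowMinor M l))
  colTerm {n} M k = sgn (toℕ k) * (M k Fin.zero * det n (colMinor M k))

  det-cong : ∀ n {M N : Matrix n} → (∀ i j → M i j ≈ N i j) → det n M ≈ det n N
  det-cong zero    M≈N = refl
  det-cong (suc n) {M} {N} M≈N = ∑-cong (rowTerm M) (rowTerm N) (λ l → *-congˡ (*-cong (M≈N Fin.zero l) (det-cong n (λ k l' → M≈N (Fin.suc k) (punchIn l l')))))

  det-cong-≡ : ∀ n {M N : Matrix n} → (∀ i j → M i j ≡ N i j) → det n M ≈ det n N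
  det-cong-≡ n M≡N = det-cong n (λ i j → reflexive (M≡N i j))

  neg-into-∑ : ∀ {q} x y (h : Fin q → R) → (- x) * (y * ∑ h) ≈ ∑ (λ k → - (x * (y * h k)))
  neg-into-∑ x y h = trans (neg-*ˡ x _) (trans (-‿cong (trans (*-congˡ (∑-*ˡ y h)) (∑-*ˡ x (λ k → y * h k)))) (∑-neg (λ k → x * (y * h k))))

  -- The double sum obtained by expanding along the first row and then along
  -- the first column equals the one obtained in the other order.
  expansion-swap : ∀ {p q} (s a : Fin p → R) (t b : Fin q → R) (g : Fin q → Fin p → R) →
    ∑ (λ l → (- s l) * (a l * ∑ (λ k → t k * (b k * g k l)))) ≈
    ∑ (λ k → (- t k) * (b k * ∑ (λ l → s l * (a l * g k l))))
  expansion-swap s a t b g = begin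
    ∑ (λ l → (- s l) * (a l * ∑ (λ k → t k * (b k * g k l))))
      ≈⟨ ∑-cong _ _ (λ l → neg-into-∑ (s l) (a l) (λ k → t k * (b k * g k l))) ⟩
    ∑ (λ l → ∑ (λ k → - (s l * (a l * (t k * (b k * g k l))))))
      ≈⟨ ∑-swap (λ l k → - (s l * (a l * (t k * (b k * g k l))))) ⟩
    ∑ (λ k → ∑ (λ l → - (s l * (a l * (t k * (b k * g k l))))))
      ≈⟨ ∑-cong _ _ (λ k → ∑-cong _ _ (λ l → -‿cong (reorder (s l) (a l) (t k) (b k) (g k l)))) ⟩
    ∑ (λ k → ∑ (λ l → - (t k * (b k * (s l * (a l * g k l))))))
      ≈⟨ ∑-cong _ _ (λ k → sym (neg-into-∑ (t k) (b k) (λ l → s l * (a l * g k l)))) ⟩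
    ∑ (λ k → (- t k) * (b k * ∑ (λ l → s l * (a l * g k l)))) ∎
    where
    reorder : ∀ s a t b g → s * (a * (t * (b * g))) ≈ t * (b * (s * (a * g)))
    reorder = solve 5 (λ s a t b g → (s :* (a :* (t :* (b :* g)))) := (t :* (b :* (s :* (a :* g))))) refl

  det-colExpansion : ∀ n (M : Matrix (suc n)) → det (suc n) M ≈ ∑ (colTerm M)
  det-colExpansion zero    M = refl
  det-colExpansion (suc n) M = +-congˡ (trans
    (∑-cong (λ l → rowTerm M (Fin.suc l)) _ (λ l → *-congˡ (*-congˡ (det-colExpansion n (rowMinor M (Fin.suc l))))))
    (expansion-swap (λ l → sgn (toℕ l)) (λ l → M Fin.zero (Fin.suc l)) (λ k → sgn (toℕ k)) (λ k → M (Fin.suc k) Fin.zero)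
                    (λ k l → det n (λ k' l' → M (Fin.suc (punchIn k k')) (Fin.suc (punchIn l l'))))))

  det-transpose : ∀ n (M : Matrix n) → det n (transpose M) ≈ det n M
  det-transpose zero    M = refl
  det-transpose (suc n) M =
    trans (∑-cong _ (colTerm M) (λ l → *-congˡ (*-congˡ (det-transpose n (colMinor M l))))) (sym (det-colExpansion n M))

  swap₀₁ : ∀ {n} → Fin (suc (suc n)) → Fin (suc (suc n))
  swap₀₁ Fin.zero                 = Fin.suc Fin.zero
  swap₀₁ (Fin.suc Fin.zero)       = Fin.zero
  swap₀₁ (Fin.suc (Fin.suc j))    = Fin.suc (Fin.suc j)

  det-swap₀₁ : ∀ n (M : Matrix (suc (suc n))) → det (suc (suc n)) (λ i j → M i (swap₀₁ j)) ≈ - det (suc (suc n)) M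
  rowTerms-swap₀₁ : ∀ n (M : Matrix (suc (suc n))) →
    ∑ (λ l → rowTerm (λ i j → M i (swap₀₁ j)) (Fin.suc (Fin.suc l))) ≈ - ∑ (λ l → rowTerm M (Fin.suc (Fin.suc l)))
  det-swap₀₁ n M = trans (+-cong first (+-cong second (rowTerms-swap₀₁ n M))) (regroup _ _ _)
    where
    M' : Matrix (suc (suc n))
    M' i j = M i (swap₀₁ j)
    first : rowTerm M' Fin.zero ≈ - rowTerm M (Fin.suc Fin.zero)
    first = trans (*-congˡ (*-congˡ (det-cong-≡ (suc n) {M = rowMinor M' Fin.zero} {N = rowMinor M (Fin.suc Fin.zero)} (λ k → λ { Fin.zero → ≡.refl ; (Fin.suc j) → ≡.refl }))))
                  (sym (trans (-‿cong (neg-*ˡ 1# _)) (-‿involutive _)))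
    second : rowTerm M' (Fin.suc Fin.zero) ≈ - rowTerm M Fin.zero
    second = trans (*-congˡ (*-congˡ (det-cong-≡ (suc n) {M = rowMinor M' (Fin.suc Fin.zero)} {N = rowMinor M Fin.zero} (λ k → λ { Fin.zero → ≡.refl ; (Fin.suc j) → ≡.refl })))) (neg-*ˡ _ _)
    regroup : ∀ X Y Z → - X + (- Y + - Z) ≈ - (Y + (X + Z))
    regroup X Y Z = sym (begin
      - (Y + (X + Z))      ≈⟨ trans (neg-+ _ _) (+-congˡ (neg-+ _ _)) ⟩
      - Y + (- X + - Z)    ≈⟨ solve 3 (λ a b c → (a :+ (b :+ c)) := (b :+ (a :+ c))) refl (- Y) (- X) (- Z) ⟩
      - X + (- Y + - Z)    ∎)
  rowTerms-swap₀₁ zero    M = sym -0#≈0#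
  rowTerms-swap₀₁ (suc n) M = trans (∑-cong _ (λ l → - rowTerm M (Fin.suc (Fin.suc l))) term) (sym (∑-neg (λ l → rowTerm M (Fin.suc (Fin.suc l)))))
    where
    minor : ∀ l k j → rowMinor (λ i j → M i (swap₀₁ j)) (Fin.suc (Fin.suc l)) k j ≡ rowMinor M (Fin.suc (Fin.suc l)) k (swap₀₁ j)
    minor l k Fin.zero = ≡.refl
    minor l k (Fin.suc Fin.zero) = ≡.refl
    minor l k (Fin.suc (Fin.suc j)) = ≡.refl
    term : ∀ l → rowTerm (λ i j → M i (swap₀₁ j)) (Fin.suc (Fin.suc l)) ≈ - rowTerm M (Fin.suc (Fin.suc l))
    term l = trans (*-congˡ (*-congˡ (trans (det-cong-≡ (suc (suc n)) (minor l)) (det-swap₀₁ n (rowMinor M (Fin.suc (Fin.suc l)))))))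
                   (trans (*-congˡ (neg-*ʳ _ _)) (neg-*ʳ _ _))

  rotate : ∀ {n} → Fin (suc n) → Fin (suc n) → Fin (suc n)
  rotate k Fin.zero    = k
  rotate k (Fin.suc i) = punchIn k i

  det-rotateColumns : ∀ n (k : Fin (suc n)) (M : Matrix (suc n)) →
                      det (suc n) (λ i j → M i (rotate k j)) ≈ sgn (toℕ k) * det (suc n) M
  det-rotateColumns n Fin.zero M =
    trans (det-cong-≡ (suc n) {M = λ i j → M i (rotate Fin.zero j)} {N = M} (λ i → λ { Fin.zero → ≡.refl ; (Fin.suc j) → ≡.refl })) (sym (*-identityˡ _))
  det-rotateColumns (suc n) (Fin.suc k) M = begin
    det (suc (suc n)) X                                 ≈⟨ sym (-‿involutive _) ⟩
    - - det (suc (suc n)) X                             ≈⟨ -‿cong (sym (det-swap₀₁ n X)) ⟩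
    - det (suc (suc n)) (λ i j → X i (swap₀₁ j))        ≈⟨ -‿cong (det-cong-≡ (suc (suc n)) {M = λ i j → X i (swap₀₁ j)} {N = Y} swapped) ⟩
    - det (suc (suc n)) Y                               ≈⟨ -‿cong (det-colExpansion _ Y) ⟩
    - ∑ (colTerm Y)                                     ≈⟨ -‿cong (∑-cong (colTerm Y) _ (λ r → trans (*-congˡ (*-congˡ (det-rotateColumns n k (colMinor M r)))) (reorder _ _ _ _))) ⟩
    - ∑ (λ r → sgn (toℕ k) * colTerm M r)               ≈⟨ -‿cong (sym (∑-*ˡ (sgn (toℕ k)) (colTerm M))) ⟩
    - (sgn (toℕ k) * ∑ (colTerm M))                     ≈⟨ sym (neg-*ˡ _ _) ⟩
    (- sgn (toℕ k)) * ∑ (colTerm M)                     ≈⟨ *-congˡ (sym (det-colExpansion _ M)) ⟩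
    (- sgn (toℕ k)) * det (suc (suc n)) M               ∎
    where
    -- X moves column k+1 to the front; swapping its first two columns gives Y,
    -- which keeps column 0 and moves column k+1 to position 1.
    X Y : Matrix (suc (suc n))
    X i j = M i (rotate (Fin.suc k) j)
    Y i Fin.zero    = M i Fin.zero
    Y i (Fin.suc j) = M i (Fin.suc (rotate k j))
    swapped : ∀ i j → X i (swap₀₁ j) ≡ Y i j
    swapped i Fin.zero                 = ≡.refl
    swapped i (Fin.suc Fin.zero)       = ≡.refl
    swapped i (Fin.suc (Fin.suc j))    = ≡.refl
    reorder : ∀ s m k D → s * (m * (k * D)) ≈ k * (s * (m * D))
    reorder = solve 4 (λ s m k D → (s :* (m :* (k :* D))) := (k :* (s :* (m :* D)))) refl

  det-equalColumns : ∀ n (M : Matrix (suc n)) (i j : Fin (suc n)) → i ≢ j → (∀ r → M r i ≈ M r j) → det (suc n) M ≈ 0#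
  det-equalColumn₀ : ∀ n (M : Matrix (suc (suc n))) (j : Fin (suc n)) → (∀ r → M r Fin.zero ≈ M r (Fin.suc j)) →
                     det (suc (suc n)) M ≈ 0#
  det-equalColumns n       M Fin.zero        Fin.zero        i≢j _ = ⊥-elim (i≢j ≡.refl)
  det-equalColumns zero    M Fin.zero        (Fin.suc ())    _   _
  det-equalColumns zero    M (Fin.suc ())    _               _   _
  det-equalColumns (suc n) M Fin.zero        (Fin.suc j)     _   eq = det-equalColumn₀ n M j eq
  det-equalColumns (suc n) M (Fin.suc i)     Fin.zero        _   eq = det-equalColumn₀ n M i (λ r → sym (eq r))
  det-equalColumns (suc n) M (Fin.suc i)     (Fin.suc j)     i≢j eq = trans (det-colExpansion (suc n) M)
    (∑-zero (colTerm M) (λ r → *≈0ʳ _ (*≈0ʳ _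
      (det-equalColumns n (colMinor M r) i j (i≢j ∘ cong Fin.suc) (λ a → eq (punchIn r a))))))
  -- Expanding along the first row, only the terms of columns 0 and j+1 survive;
  -- they cancel because their minors differ by moving column j to the front.
  det-equalColumn₀ n M j eq =
    trans (+-congˡ (∑-single (λ l → rowTerm M (Fin.suc l)) j others))
          (trans (+-congˡ (*-congˡ (*-cong (sym (eq Fin.zero)) rotated))) (cancel (sgn (toℕ j)) _ _ (sgn-sq (toℕ j))))
    where
    others : ∀ l → l ≢ j → rowTerm M (Fin.suc l) ≈ 0#
    others l l≢j = *≈0ʳ _ (*≈0ʳ _ (det-equalColumns n (rowMinor M (Fin.suc l)) Fin.zero (Fin.suc (punchOut l≢j)) (λ ())
      (λ k → trans (eq (Fin.suc k)) (reflexive (cong (λ z → M (Fin.suc k) (Fin.suc z)) (≡.sym (FinP.punchIn-punchOut l≢j)))))))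
    rotated : det (suc n) (rowMinor M (Fin.suc j)) ≈ sgn (toℕ j) * det (suc n) (rowMinor M Fin.zero)
    rotated = trans (det-cong (suc n) {M = rowMinor M (Fin.suc j)} {N = λ a b → rowMinor M Fin.zero a (rotate j b)}
                       (λ a → λ { Fin.zero → eq (Fin.suc a) ; (Fin.suc b) → refl }))
                    (det-rotateColumns n j (rowMinor M Fin.zero))
    cancel : ∀ s m D → s * s ≈ 1# → 1# * (m * D) + (- s) * (m * (s * D)) ≈ 0#
    cancel s m D s²≈1 = begin
      1# * (m * D) + (- s) * (m * (s * D))  ≈⟨ +-cong (*-identityˡ _) (trans (neg-*ˡ _ _) (-‿cong (regroup s m D))) ⟩
      m * D + - ((s * s) * (m * D))          ≈⟨ +-congˡ (-‿cong (trans (*-congʳ s²≈1) (*-identityˡ _))) ⟩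
      m * D + - (m * D)                      ≈⟨ -‿inverseʳ _ ⟩
      0#                                     ∎
      where
      regroup : ∀ s m D → s * (m * (s * D)) ≈ (s * s) * (m * D)
      regroup = solve 3 (λ s m D → (s :* (m :* (s :* D))) := ((s :* s) :* (m :* D))) refl

  det-combine : ∀ n (M : Matrix (suc n)) {p} (a : Fin p → R) (N : Fin p → Matrix (suc n)) →
                (∀ r → colTerm M r ≈ ∑ (λ q → a q * colTerm (N q) r)) → det (suc n) M ≈ ∑ (λ q → a q * det (suc n) (N q))
  det-combine n M a N terms = begin
    det (suc n) M                                  ≈⟨ det-colExpansion n M ⟩
    ∑ (colTerm M)                                  ≈⟨ ∑-cong (colTerm M) _ terms ⟩
    ∑ (λ r → ∑ (λ q → a q * colTerm (N q) r))      ≈⟨ ∑-swap (λ r q → a q * colTerm (N q) r) ⟩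
    ∑ (λ q → ∑ (λ r → a q * colTerm (N q) r))      ≈⟨ ∑-cong _ _ (λ q → sym (trans (*-congˡ (det-colExpansion n (N q))) (∑-*ˡ (a q) (colTerm (N q))))) ⟩
    ∑ (λ q → a q * det (suc n) (N q))              ∎

  det-linearColumn : ∀ n (i : Fin n) (M : Matrix n) {p} (a : Fin p → R) (N : Fin p → Matrix n) →
                     (∀ q r col → col ≢ i → N q r col ≈ M r col) →
                     (∀ r → M r i ≈ ∑ (λ q → a q * N q r i)) →
                     det n M ≈ ∑ (λ q → a q * det n (N q))
  det-linearColumn (suc n) Fin.zero M {p} a N agree column = det-combine n M a N term
    where
    term : ∀ r → colTerm M r ≈ ∑ (λ q → a q * colTerm (N q) r)
    term r = begin
      sgn (toℕ r) * (M r Fin.zero * det n (colMinor M r))                      ≈⟨ *-congˡ (*-congʳ (column r)) ⟩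
      sgn (toℕ r) * (∑ (λ q → a q * N q r Fin.zero) * det n (colMinor M r))    ≈⟨ *-congˡ (∑-*ʳ _ (λ q → a q * N q r Fin.zero)) ⟩
      sgn (toℕ r) * ∑ (λ q → a q * N q r Fin.zero * det n (colMinor M r))      ≈⟨ ∑-*ˡ _ (λ q → a q * N q r Fin.zero * det n (colMinor M r)) ⟩
      ∑ (λ q → sgn (toℕ r) * (a q * N q r Fin.zero * det n (colMinor M r)))    ≈⟨ ∑-cong _ _ (λ q →
          trans (*-congˡ (*-congˡ (det-cong n {M = colMinor M r} {N = colMinor (N q) r} (λ k l → sym (agree q _ _ (λ ()))))))
                (reorder _ _ _ _)) ⟩
      ∑ (λ q → a q * colTerm (N q) r)                                          ∎
      where
      reorder : ∀ s a m D → s * ((a * m) * D) ≈ a * (s * (m * D))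
      reorder = solve 4 (λ s a m D → (s :* ((a :* m) :* D)) := (a :* (s :* (m :* D)))) refl
  det-linearColumn (suc n) (Fin.suc i) M {p} a N agree column = det-combine n M a N term
    where
    term : ∀ r → colTerm M r ≈ ∑ (λ q → a q * colTerm (N q) r)
    term r = begin
      sgn (toℕ r) * (M r Fin.zero * det n (colMinor M r))                      ≈⟨ *-congˡ (*-congˡ minor) ⟩
      sgn (toℕ r) * (M r Fin.zero * ∑ (λ q → a q * det n (colMinor (N q) r)))  ≈⟨ *-congˡ (∑-*ˡ _ (λ q → a q * det n (colMinor (N q) r))) ⟩
      sgn (toℕ r) * ∑ (λ q → M r Fin.zero * (a q * det n (colMinor (N q) r)))  ≈⟨ ∑-*ˡ _ (λ q → M r Fin.zero * (a q * det n (colMinor (N q) r))) ⟩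
      ∑ (λ q → sgn (toℕ r) * (M r Fin.zero * (a q * det n (colMinor (N q) r)))) ≈⟨ ∑-cong _ _ (λ q →
          trans (*-congˡ (*-congʳ (sym (agree q r Fin.zero (λ ()))))) (reorder _ _ _ _)) ⟩
      ∑ (λ q → a q * colTerm (N q) r)                                          ∎
      where
      minor : det n (colMinor M r) ≈ ∑ (λ q → a q * det n (colMinor (N q) r))
      minor = det-linearColumn n i (colMinor M r) a (λ q → colMinor (N q) r)
                (λ q r' col col≢i → agree q _ _ (col≢i ∘ FinP.suc-injective)) (λ r' → column (punchIn r r'))
      reorder : ∀ s m a D → s * (m * (a * D)) ≈ a * (s * (m * D))
      reorder = solve 4 (λ s m a D → (s :* (m :* (a :* D))) := (a :* (s :* (m :* D)))) refl

  det-zeroColumn : ∀ n (M : Matrix n) (i : Fin n) → (∀ r → M r i ≈ 0#) → det n M ≈ 0#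
  det-zeroColumn n M i zero-col = det-linearColumn n i M {0} (λ ()) (λ ()) (λ ()) zero-col

  replaceColumn : ∀ {m} → Matrix m → Fin m → (Fin m → R) → Matrix m
  replaceColumn M i v r col with col Fin.≟ i
  ... | yes _ = v r
  ... | no _  = M r col

  replaceColumn-at : ∀ {m} (M : Matrix m) i v r → replaceColumn M i v r i ≡ v r
  replaceColumn-at M i v r with i Fin.≟ i
  ... | yes _   = ≡.refl
  ... | no i≢i = ⊥-elim (i≢i ≡.refl)

  replaceColumn-off : ∀ {m} (M : Matrix m) i v r col → col ≢ i → replaceColumn M i v r col ≡ M r col
  replaceColumn-off M i v r col col≢i with col Fin.≟ i
  ... | yes col≡i = ⊥-elim (col≢i col≡i)
  ... | no _      = ≡.refl

  replaceColumn-self : ∀ {m} (M : Matrix m) i r col → replaceColumn M i (λ r' → M r' i) r col ≡ M r col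
  replaceColumn-self M i r col with col Fin.≟ i
  ... | yes col≡i = cong (M r) (≡.sym col≡i)
  ... | no _      = ≡.refl

  -- Cramer's rule in the form needed here: if M a = 0 then det M · aᵢ = 0.
  -- Replacing column i of M by M a = 0 gives determinant 0; by linearity that
  -- determinant is ∑_q a_q · det(M with column i replaced by column q), and
  -- every term but q = i has two equal columns.
  det-kernel : ∀ n (M : Matrix (suc n)) (a : Fin (suc n) → R) → (∀ r → ∑ (λ j → M r j * a j) ≈ 0#) →
               ∀ i → det (suc n) M * a i ≈ 0#
  det-kernel n M a Ma≈0 i = begin
    det (suc n) M * a i                    ≈⟨ *-comm _ _ ⟩
    a i * det (suc n) M                    ≈⟨ *-congˡ (sym (det-cong-≡ (suc n) {M = N i} {N = M} (replaceColumn-self M i))) ⟩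
    a i * det (suc n) (N i)                ≈⟨ sym (∑-single (λ q → a q * det (suc n) (N q)) i others) ⟩
    ∑ (λ q → a q * det (suc n) (N q))      ≈⟨ sym expand ⟩
    det (suc n) M₀                         ≈⟨ det-zeroColumn (suc n) M₀ i (λ r → reflexive (replaceColumn-at M i _ r)) ⟩
    0#                                     ∎
    where
    M₀ : Matrix (suc n)
    M₀ = replaceColumn M i (λ _ → 0#)
    N : Fin (suc n) → Matrix (suc n)
    N q = replaceColumn M i (λ r → M r q)
    expand : det (suc n) M₀ ≈ ∑ (λ q → a q * det (suc n) (N q))
    expand = det-linearColumn (suc n) i M₀ a N
      (λ q r col col≢i → reflexive (≡.trans (replaceColumn-off M i _ r col col≢i) (≡.sym (replaceColumn-off M i _ r col col≢i))))
      (λ r → trans (reflexive (replaceColumn-at M i _ r)) (sym (trans (∑-cong (λ q → a q * N q r i) (λ j → M r j * a j)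
         (λ q → trans (*-congˡ (reflexive (replaceColumn-at M i _ r))) (*-comm _ _))) (Ma≈0 r))))
    others : ∀ q → q ≢ i → a q * det (suc n) (N q) ≈ 0#
    others q q≢i = *≈0ʳ _ (det-equalColumns n (N q) i q (q≢i ∘ ≡.sym)
      (λ r → reflexive (≡.trans (replaceColumn-at M i _ r) (≡.sym (replaceColumn-off M i _ r q q≢i)))))

  det-equalRows : ∀ n (M : Matrix (suc n)) (i j : Fin (suc n)) → i ≢ j → (∀ col → M i col ≈ M j col) → det (suc n) M ≈ 0#
  det-equalRows n M i j i≢j eq = trans (det-transpose (suc n) (transpose M)) (det-equalColumns n (transpose M) i j i≢j eq)

  det-rotateRows : ∀ n (k : Fin (suc n)) (M : Matrix (suc n)) → det (suc n) (λ i j → M (rotate k i) j) ≈ sgn (toℕ k) * det (suc n) M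
  det-rotateRows n k M = trans (det-transpose (suc n) (λ a b → M (rotate k b) a))
    (trans (det-rotateColumns n k (transpose M)) (*-congˡ (det-transpose (suc n) M)))

  det-zeroRow : ∀ n (M : Matrix n) (i : Fin n) → (∀ col → M i col ≈ 0#) → det n M ≈ 0#
  det-zeroRow n M i zero-row = trans (det-transpose n (transpose M)) (det-zeroColumn n (transpose M) i zero-row)

-- Write D m t for the determinant of the
-- m×m block of T on rows 0..m-1 and columns t..t+m-1 (that is, det T[t,t+m-1]
-- for m ≥ 1, and 1 for m = 0).  For λ = (r,s,t) ∈ △_d the vector
--   canonical s t = T·a,  a_{t+l} = (-1)^l · det(block on rows 0..s-1 and
--                         columns t..t+s without column t+l),  a_j = 0 otherwise,
-- has k-th coordinate the determinant of the block on columns t..t+s with row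
-- k of T put on top of rows 0..s-1.  This lies in U_{d-r}, U'_{d-s} and
-- U''_{d-t}, and its coordinate s is ±D(s+1,t) ≠ 0.  Conversely B_λ = 0 when
-- the coordinates of λ sum to d+1 (back substitution in the triangular T,
-- then invertibility of a block); hence B_λ is the line of `canonical s t`.
module BilliardArray {c ℓ} (F : Field c ℓ) (d : ℕ) (T : WithField.Mat F d) (vg : WithField.VeryGood F T) where
  open Field F hiding (zero)
  open WithField F
  open FieldFacts F
  open Determinants F
  open import Relation.Binary.Reasoning.Setoid setoid
  open import Algebra.Solver.Ring.NaturalCoefficients.Default commutativeSemiring using (solve; _:=_; _:*_)

  A : ℕ → ℕ → R
  A = at T

  A-toℕ : ∀ k l → A (toℕ k) (toℕ l) ≡ T k l
  A-toℕ k l with toℕ k <? suc d | toℕ l <? suc d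
  ... | yes k< | yes l< = cong₂ T (FinP.fromℕ<-toℕ k k<) (FinP.fromℕ<-toℕ l l<)
  ... | yes _  | no l≮  = ⊥-elim (l≮ (FinP.toℕ<n l))
  ... | no k≮  | _      = ⊥-elim (k≮ (FinP.toℕ<n k))

  A-lower : ∀ i j → j < i → A i j ≈ 0#
  A-lower i j j<i with i <? suc d | j <? suc d
  ... | yes i< | yes j< = proj₁ vg (fromℕ< i<) (fromℕ< j<)
                            (≡.subst₂ _<_ (≡.sym (FinP.toℕ-fromℕ< j<)) (≡.sym (FinP.toℕ-fromℕ< i<)) j<i)
  ... | yes _  | no _   = refl
  ... | no _   | _      = refl

  block : ∀ m → ℕ → Matrix m
  block m t k l = A (toℕ k) (t +ₙ toℕ l)

  D : ℕ → ℕ → R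
  D m t = det m (block m t)

  -- Every block inside T is invertible: D(s+1,t) = det T[t,t+s].
  D-nonzero : ∀ m t → t +ₙ m ≤ suc d → ¬ (D m t ≈ 0#)
  D-nonzero zero    t _  = 1≉0
  D-nonzero (suc s) t le = ≡.subst (λ n → ¬ (D (suc n) t ≈ 0#)) (ℕP.m+n∸m≡n t s)
    (proj₂ vg t (t +ₙ s) (ℕP.m≤m+n t s) (ℕP.≤-pred (≡.subst (_≤ suc d) (ℕP.+-suc t s) le)))

  -- The diagonal of T is nonzero: otherwise the last row of T[0,j] vanishes.
  diagonal-nonzero : ∀ j → j ≤ d → ¬ (A j j ≈ 0#)
  diagonal-nonzero j j≤d Ajj≈0 = proj₂ vg 0 j z≤n j≤d (det-zeroRow (suc j) (block (suc j) 0) (Fin.fromℕ j) last-row)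
    where
    last-row : ∀ col → A (toℕ (Fin.fromℕ j)) (toℕ col) ≈ 0#
    last-row col with toℕ col <? j
    ... | yes col<j = trans (reflexive (cong (λ i → A i (toℕ col)) (FinP.toℕ-fromℕ j))) (A-lower j (toℕ col) col<j)
    ... | no col≮j  = trans (reflexive (cong₂ A (FinP.toℕ-fromℕ j)
                              (ℕP.≤-antisym (ℕP.≤-pred (FinP.toℕ<n col)) (ℕP.≮⇒≥ col≮j)))) Ajj≈0

  -- The coordinates of T·a, the vector with coefficients a in the basis v.
  T· : (Fin (suc d) → R) → Vec d
  T· a k = ∑ (λ j → T k j * a j)

  T·-Σ< : ∀ (a : Fin (suc d) → R) (ξ : ℕ → R) → (∀ j → a j ≈ ξ (toℕ j)) → ∀ k →
          T· a k ≈ Σ< (suc d) (λ j → A (toℕ k) j * ξ j)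
  T·-Σ< a ξ a≈ξ k = ∑-cong _ _ (λ j → *-cong (reflexive (≡.sym (A-toℕ k j))) (a≈ξ j))

  T·-combine : ∀ (a b : Fin (suc d) → R) κ k → T· (λ j → a j + κ * b j) k ≈ T· a k + κ * T· b k
  T·-combine a b κ k = begin
    ∑ (λ j → T k j * (a j + κ * b j))              ≈⟨ ∑-cong _ (λ j → T k j * a j + κ * (T k j * b j)) (λ j →
                                                        trans (distribˡ _ _ _) (+-congˡ (swap-factors _ _ _))) ⟩
    ∑ (λ j → T k j * a j + κ * (T k j * b j))      ≈⟨ ∑-+ (λ j → T k j * a j) (λ j → κ * (T k j * b j)) ⟩
    T· a k + ∑ (λ j → κ * (T k j * b j))           ≈⟨ +-congˡ (sym (∑-*ˡ κ (λ j → T k j * b j))) ⟩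
    T· a k + κ * T· b k                            ∎
    where
    swap-factors : ∀ t κ b → t * (κ * b) ≈ κ * (t * b)
    swap-factors = solve 3 (λ t κ b → (t :* (κ :* b)) := (κ :* (t :* b))) refl

  combine≈0 : ∀ {x y} κ → x ≈ 0# → y ≈ 0# → x + κ * y ≈ 0#
  combine≈0 κ x≈0 y≈0 = trans (+-cong x≈0 (*≈0ʳ κ y≈0)) (+-identityʳ 0#)

  InU-combine : ∀ i {x y : Vec d} κ → InU i x → InU i y → InU i (x +V (κ ·V y))
  InU-combine i κ x∈U y∈U k i<k = combine≈0 κ (x∈U k i<k) (y∈U k i<k)

  InU'-combine : ∀ i {x y : Vec d} κ → InU' i x → InU' i y → InU' i (x +V (κ ·V y))
  InU'-combine i κ x∈U' y∈U' k k< = combine≈0 κ (x∈U' k k<) (y∈U' k k<)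

  InU''-combine : ∀ i {x y : Vec d} κ → InU'' T i x → InU'' T i y → InU'' T i (x +V (κ ·V y))
  InU''-combine i κ (a , a-low , x≈Ta) (b , b-low , y≈Tb) =
    (λ j → a j + κ * b j) , (λ j j< → combine≈0 κ (a-low j j<) (b-low j j<)) ,
    (λ k → trans (+-cong (x≈Ta k) (*-congˡ (y≈Tb k))) (sym (T·-combine a b κ k)))

  InB-combine : ∀ loc {x y : Vec d} κ → InB T loc x → InB T loc y → InB T loc (x +V (κ ·V y))
  InB-combine (r , s , t) κ (x∈U , x∈U' , x∈U'') (y∈U , y∈U' , y∈U'') =
    InU-combine (d ∸ r) κ x∈U y∈U , InU'-combine (d ∸ s) κ x∈U' y∈U' , InU''-combine (d ∸ t) κ x∈U'' y∈U''

  InB-cong : ∀ loc {x y : Vec d} → x ≈V y → InB T loc x → InB T loc y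
  InB-cong (r , s , t) x≈y (x∈U , x∈U' , (a , a-low , x≈Ta)) =
    (λ k h<k → trans (sym (x≈y k)) (x∈U k h<k)) , (λ k k<h → trans (sym (x≈y k)) (x∈U' k k<h)) ,
    (a , a-low , (λ k → trans (sym (x≈y k)) (x≈Ta k)))

  InB-zero : ∀ loc → InB T loc 0V
  InB-zero (r , s , t) = (λ _ _ → refl) , (λ _ _ → refl) ,
    ((λ _ → 0#) , (λ _ _ → refl) , (λ k → sym (∑-zero (λ j → T k j * 0#) (λ j → zeroʳ _))))

  InB-scale : ∀ loc {y : Vec d} κ → InB T loc y → InB T loc (κ ·V y)
  InB-scale loc κ y∈B = InB-cong loc (λ k → +-identityˡ _) (InB-combine loc κ (InB-zero loc) y∈B)

  InU-mono : ∀ {i i'} {x : Vec d} → i ≤ i' → InU i x → InU i' x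
  InU-mono i≤i' x∈U k i'<k = x∈U k (ℕP.≤-<-trans i≤i' i'<k)

  InU'-mono : ∀ {i i'} {x : Vec d} → i ≤ i' → InU' i x → InU' i' x
  InU'-mono i≤i' x∈U' k k< = x∈U' k (ℕP.<-≤-trans k< (ℕP.∸-monoʳ-≤ d i≤i'))

  InU''-mono : ∀ {i i'} {x : Vec d} → i ≤ i' → InU'' T i x → InU'' T i' x
  InU''-mono i≤i' (a , a-low , x≈Ta) = a , (λ j j< → a-low j (ℕP.<-≤-trans j< (ℕP.∸-monoʳ-≤ d i≤i'))) , x≈Ta

  cofactor : ∀ s t → Fin (suc s) → R
  cofactor s t l = sgn (toℕ l) * det s (λ k l' → A (toℕ k) (t +ₙ toℕ (punchIn l l')))

  coeffs : ℕ → ℕ → ℕ → R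
  coeffs s t = delay t (zeroExtend (cofactor s t))

  canonical : ℕ → ℕ → Vec d
  canonical s t = T· (λ j → coeffs s t (toℕ j))

  bordered : ∀ s → ℕ → ℕ → Matrix (suc s)
  bordered s t k Fin.zero     l = A k (t +ₙ toℕ l)
  bordered s t k (Fin.suc k') l = A (toℕ k') (t +ₙ toℕ l)

  borderedDet : ℕ → ℕ → ℕ → R
  borderedDet s t k = det (suc s) (bordered s t k)

  -- The coordinates of the canonical vector are bordered determinants
  -- (the first-row expansion of the latter).
  canonical-bordered : ∀ s t (k : Fin (suc d)) → t +ₙ suc s ≤ suc d → canonical s t k ≈ borderedDet s t (toℕ k)
  canonical-bordered s t k fits = begin
    canonical s t k                                             ≈⟨ T·-Σ< _ (coeffs s t) (λ _ → refl) k ⟩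
    Σ< (suc d) (λ j → A (toℕ k) j * coeffs s t j)               ≈⟨ Σ<-window t (suc s) (suc d) (λ j → A (toℕ k) j * coeffs s t j) fits below above ⟩
    Σ< (suc s) (λ l → A (toℕ k) (t +ₙ l) * coeffs s t (t +ₙ l)) ≈⟨ Σ<-cong (suc s) _ (λ l → A (toℕ k) (t +ₙ l) * zeroExtend (cofactor s t) l) (λ l _ → *-congˡ (reflexive (delay-at t (zeroExtend (cofactor s t)) l))) ⟩
    Σ< (suc s) (λ l → A (toℕ k) (t +ₙ l) * zeroExtend (cofactor s t) l) ≈⟨ Σ<-zeroExtend (suc s) (λ l → A (toℕ k) (t +ₙ l)) (cofactor s t) ⟩
    ∑ (λ l → A (toℕ k) (t +ₙ toℕ l) * cofactor s t l)          ≈⟨ ∑-cong _ (rowTerm (bordered s t (toℕ k))) (λ l → reorder _ _ _) ⟩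
    borderedDet s t (toℕ k)                                     ∎
    where
    below : ∀ j → j < t → A (toℕ k) j * coeffs s t j ≈ 0#
    below j j<t = *≈0ʳ _ (reflexive (delay-below t _ j j<t))
    above : ∀ j → t +ₙ suc s ≤ j → A (toℕ k) j * coeffs s t j ≈ 0#
    above j le = *≈0ʳ _ (reflexive (≡.trans (delay-from t _ j (ℕP.≤-trans (ℕP.m≤m+n t (suc s)) le))
                   (zeroExtend-beyond (cofactor s t) (j ∸ t) (ℕP.m+n≤o⇒m≤o∸n (suc s) (≡.subst (_≤ j) (ℕP.+-comm t (suc s)) le)))))
    reorder : ∀ a σ D → a * (σ * D) ≈ σ * (a * D)
    reorder = solve 3 (λ a σ D → (a :* (σ :* D)) := (σ :* (a :* D))) refl

  -- Below the block the row of T vanishes on columns t..t+s (T is upper triangular).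
  borderedDet-above : ∀ s t k → t +ₙ s < k → borderedDet s t k ≈ 0#
  borderedDet-above s t k t+s<k = det-zeroRow (suc s) (bordered s t k) Fin.zero
    (λ col → A-lower k (t +ₙ toℕ col) (ℕP.≤-<-trans (ℕP.+-monoʳ-≤ t (ℕP.≤-pred (FinP.toℕ<n col))) t+s<k))

  -- For k < s the row k occurs twice.
  borderedDet-repeat : ∀ s t k → k < s → borderedDet s t k ≈ 0#
  borderedDet-repeat s t k k<s = det-equalRows s (bordered s t k) Fin.zero (Fin.suc (fromℕ< k<s)) (λ ())
    (λ col → reflexive (cong (λ i → A i (t +ₙ toℕ col)) (≡.sym (FinP.toℕ-fromℕ< k<s))))

  toℕ-punchIn-last : ∀ n (i : Fin n) → toℕ (punchIn (Fin.fromℕ n) i) ≡ toℕ i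
  toℕ-punchIn-last (suc n) Fin.zero    = ≡.refl
  toℕ-punchIn-last (suc n) (Fin.suc i) = cong suc (toℕ-punchIn-last n i)

  -- For k = s the bordered matrix is the (s+1)-block with its last row moved to the top.
  borderedDet-diagonal : ∀ s t → borderedDet s t s ≈ sgn s * D (suc s) t
  borderedDet-diagonal s t =
    trans (det-cong-≡ (suc s) {M = bordered s t s} {N = λ i j → block (suc s) t (rotate (Fin.fromℕ s) i) j} rows)
          (trans (det-rotateRows s (Fin.fromℕ s) (block (suc s) t)) (*-congʳ (reflexive (cong sgn (FinP.toℕ-fromℕ s)))))
    where
    rows : ∀ i j → bordered s t s i j ≡ block (suc s) t (rotate (Fin.fromℕ s) i) j
    rows Fin.zero     j = cong (λ i → A i (t +ₙ toℕ j)) (≡.sym (FinP.toℕ-fromℕ s))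
    rows (Fin.suc k') j = cong (λ i → A i (t +ₙ toℕ j)) (≡.sym (toℕ-punchIn-last s k'))

  -- For k = t+s the top row has a single nonzero entry, in the last column.
  borderedDet-corner : ∀ s t h → h ≡ t +ₙ s → borderedDet s t h ≈ sgn s * (A h h * D s t)
  borderedDet-corner s t h ≡.refl = begin
    det (suc s) (bordered s t h)                      ≈⟨ ∑-single (rowTerm (bordered s t h)) (Fin.fromℕ s) (λ l l≢s →
                                                          *≈0ʳ _ (*≈0ˡ _ (A-lower h (t +ₙ toℕ l) (ℕP.+-monoʳ-< t (before-last l l≢s))))) ⟩
    rowTerm (bordered s t h) (Fin.fromℕ s)            ≈⟨ *-cong (reflexive (cong sgn (FinP.toℕ-fromℕ s)))
                                                          (*-cong (reflexive (cong (λ z → A h (t +ₙ z)) (FinP.toℕ-fromℕ s)))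
                                                                  (det-cong-≡ s (λ k' l' → cong (λ z → A (toℕ k') (t +ₙ z)) (toℕ-punchIn-last s l')))) ⟩
    sgn s * (A h (t +ₙ s) * D s t)                    ∎
    where
    before-last : ∀ (l : Fin (suc s)) → l ≢ Fin.fromℕ s → toℕ l < s
    before-last l l≢s = ℕP.≤∧≢⇒< (ℕP.≤-pred (FinP.toℕ<n l)) (λ e → l≢s (FinP.toℕ-injective (≡.trans e (≡.sym (FinP.toℕ-fromℕ s)))))

  coeffs-first : ∀ s t → coeffs s t t ≈ D s (suc t)
  coeffs-first s t = trans (reflexive (≡.trans (cong (coeffs s t) (≡.sym (ℕP.+-identityʳ t))) (delay-at t _ 0)))
                           (trans (*-identityˡ _) (det-cong-≡ s (λ k l → cong (A (toℕ k)) (ℕP.+-suc t (toℕ l)))))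

  canonical-combine-U'' : ∀ s s' t κ → t < d → coeffs s t t + κ * coeffs s' t t ≈ 0# →
                          InU'' T (d ∸ suc t) (canonical s t +V (κ ·V canonical s' t))
  canonical-combine-U'' s s' t κ t<d first≈0 = (λ j → a j + κ * b j) , vanish , (λ k → sym (T·-combine a b κ k))
    where
    a b : Fin (suc d) → R
    a j = coeffs s t (toℕ j)
    b j = coeffs s' t (toℕ j)
    vanish : ∀ j → toℕ j < d ∸ (d ∸ suc t) → a j + κ * b j ≈ 0#
    vanish j j< with toℕ j <? t
    ... | yes j<t = combine≈0 κ (reflexive (delay-below t _ (toℕ j) j<t)) (reflexive (delay-below t _ (toℕ j) j<t))
    ... | no  j≮t = trans (reflexive (cong (λ i → coeffs s t i + κ * coeffs s' t i) j≡t)) first≈0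
      where
      j≡t : toℕ j ≡ t
      j≡t = ℕP.≤-antisym (ℕP.≤-pred (≡.subst (toℕ j <_) (ℕP.m∸[m∸n]≡n t<d) j<)) (ℕP.≮⇒≥ j≮t)

  InU'-below : ∀ {s} {x : Vec d} → s ≤ d → InU' (d ∸ s) x → ∀ k → toℕ k < s → x k ≈ 0#
  InU'-below s≤d x∈U' k k<s = x∈U' k (≡.subst (toℕ k <_) (≡.sym (ℕP.m∸[m∸n]≡n s≤d)) k<s)

  canonical-∈B : ∀ r s t → r +ₙ s +ₙ t ≡ d → InB T (r , s , t) (canonical s t)
  canonical-∈B r s t sum = in-U , in-U' , in-U''
    where
    open Coordinates {r} {s} {t} sum
    in-U : InU (d ∸ r) (canonical s t)
    in-U k h<k = trans (canonical-bordered s t k window≤) (borderedDet-above s t (toℕ k) (≡.subst (_< toℕ k) n∸r h<k))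
    in-U' : InU' (d ∸ s) (canonical s t)
    in-U' k k< = trans (canonical-bordered s t k window≤)
                       (borderedDet-repeat s t (toℕ k) (≡.subst (toℕ k <_) (ℕP.m∸[m∸n]≡n s≤n) k<))
    in-U'' : InU'' T (d ∸ t) (canonical s t)
    in-U'' = (λ j → coeffs s t (toℕ j)) ,
             (λ j j< → reflexive (delay-below t _ (toℕ j) (≡.subst (toℕ j <_) (ℕP.m∸[m∸n]≡n t≤n) j<))) ,
             (λ k → refl)

  canonical-pivot : ∀ s t (k : Fin (suc d)) → t +ₙ suc s ≤ suc d → toℕ k ≡ s → canonical s t k ≈ sgn s * D (suc s) t
  canonical-pivot s t k fits k≡s = trans (canonical-bordered s t k fits)
    (trans (reflexive (cong (borderedDet s t) k≡s)) (borderedDet-diagonal s t))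

  canonical-corner : ∀ s t (k : Fin (suc d)) → t +ₙ suc s ≤ suc d → toℕ k ≡ t +ₙ s →
                     canonical s t k ≈ sgn s * (A (toℕ k) (toℕ k) * D s t)
  canonical-corner s t k fits k≡t+s = trans (canonical-bordered s t k fits) (borderedDet-corner s t (toℕ k) k≡t+s)

  rowT : ℕ → (ℕ → R) → R
  rowT k ξ = Σ< (suc d) (λ j → A k j * ξ j)

  -- The induction is on a bound e with d < j + e.
  back-substitution : ∀ h (ξ : ℕ → R) → (∀ j → d < j → ξ j ≈ 0#) →
                      (∀ k → h < k → k ≤ d → rowT k ξ ≈ 0#) → ∀ j → h < j → ξ j ≈ 0#
  back-substitution h ξ beyond rows j h<j = go (suc d) j h<j (ℕP.m≤n+m (suc d) j)
    where
    go : ∀ e j → h < j → d < j +ₙ e → ξ j ≈ 0#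
    go zero    j h<j d<j   = beyond j (≡.subst (d <_) (ℕP.+-identityʳ j) d<j)
    go (suc e) j h<j d<j+e+1 with d <? j +ₙ e
    ... | yes d<j+e = go e j h<j d<j+e
    ... | no  d≮j+e = cancelˡ (A j j) (ξ j) (diagonal-nonzero j j≤d) (trans (sym single) (rows j h<j j≤d))
      where
      j≤d : j ≤ d
      j≤d = ℕP.m+n≤o⇒m≤o j (ℕP.≮⇒≥ d≮j+e)
      others : ∀ i → i < suc d → i ≢ j → A j i * ξ i ≈ 0#
      others i _ i≢j with i <? j
      ... | yes i<j = *≈0ˡ _ (A-lower j i i<j)
      ... | no  i≮j = *≈0ʳ _ (go e i (ℕP.<-trans h<j j<i)
                        (ℕP.≤-<-trans (ℕP.≤-pred (≡.subst (suc d ≤_) (ℕP.+-suc j e) d<j+e+1)) (ℕP.+-monoˡ-< e j<i)))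
        where
        j<i : j < i
        j<i = ℕP.≤∧≢⇒< (ℕP.≮⇒≥ i≮j) (i≢j ∘ ≡.sym)
      single : rowT j ξ ≈ A j j * ξ j
      single = Σ<-single (suc d) (λ i → A j i * ξ i) j (s≤s j≤d) others

  block-kernel : ∀ m t (β : ℕ → R) → t +ₙ m ≤ suc d →
                 (∀ k → k < m → Σ< m (λ l → A k (t +ₙ l) * β l) ≈ 0#) → ∀ l → l < m → β l ≈ 0#
  block-kernel (suc m) t β fits rows l l<m = trans (reflexive (cong β (≡.sym (FinP.toℕ-fromℕ< l<m))))
    (cancelˡ (D (suc m) t) _ (D-nonzero (suc m) t fits)
      (det-kernel m (block (suc m) t) (λ i → β (toℕ i)) (λ k → rows (toℕ k) (FinP.toℕ<n k)) (fromℕ< l<m)))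

  -- B_λ = 0 when the coordinates of λ sum to d+1.  Write x = T·ξ; ξ vanishes
  -- below t (x ∈ U''_{d-t}) and, by back substitution, above h = d-r
  -- (x ∈ U_{d-r}).  As t + s = h + 1, the coordinates 0..s-1 of x, which
  -- vanish since x ∈ U'_{d-s}, are the s×s block at column t applied to
  -- ξ_t..ξ_h; so these vanish too, and with them x.
  B-vanishes : ∀ r s t → r +ₙ s +ₙ t ≡ suc d → r ≤ d → s ≤ d → t ≤ d → ∀ x → InB T (r , s , t) x → x ≈V 0V
  B-vanishes r s t sum r≤d s≤d t≤d x (x∈U , x∈U' , (a , a-low , x≈Ta)) k =
    trans (row k) (trans (window (toℕ k)) (Σ<-zero s (λ l → A (toℕ k) (t +ₙ l) * ξ (t +ₙ l)) (λ l l<s → *≈0ʳ _ (block-zero l l<s))))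
    where
    h : ℕ
    h = d ∸ r
    t+s≡1+h : t +ₙ s ≡ suc h
    t+s≡1+h = ≡.trans (≡.sym (Coordinates.n∸r {r} {s} {t} sum)) (ℕP.+-∸-assoc 1 r≤d)
    fits : t +ₙ s ≤ suc d
    fits = ≡.subst (_≤ suc d) (≡.sym t+s≡1+h) (s≤s (ℕP.m∸n≤m d r))
    ξ : ℕ → R
    ξ = zeroExtend a
    row : ∀ k → x k ≈ rowT (toℕ k) ξ
    row k = trans (x≈Ta k) (T·-Σ< a ξ (λ j → reflexive (≡.sym (zeroExtend-toℕ a j))) k)
    row-ℕ : ∀ i (i<d+1 : i < suc d) → x (fromℕ< i<d+1) ≈ rowT i ξ
    row-ℕ i i<d+1 = ≡.subst (λ i' → x (fromℕ< i<d+1) ≈ rowT i' ξ) (FinP.toℕ-fromℕ< i<d+1) (row (fromℕ< i<d+1))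
    ξ-below : ∀ j → j < t → ξ j ≈ 0#
    ξ-below j j<t = trans (reflexive (zeroExtend-fromℕ< a j j<d+1))
      (a-low (fromℕ< j<d+1) (≡.subst₂ _<_ (≡.sym (FinP.toℕ-fromℕ< j<d+1)) (≡.sym (ℕP.m∸[m∸n]≡n t≤d)) j<t))
      where
      j<d+1 : j < suc d
      j<d+1 = ℕP.<-≤-trans j<t (ℕP.m≤n⇒m≤1+n t≤d)
    ξ-above : ∀ j → h < j → ξ j ≈ 0#
    ξ-above = back-substitution h ξ (λ j d<j → reflexive (zeroExtend-beyond a j d<j))
      (λ i h<i i≤d → trans (sym (row-ℕ i (s≤s i≤d)))
                           (x∈U (fromℕ< (s≤s i≤d)) (≡.subst (h <_) (≡.sym (FinP.toℕ-fromℕ< (s≤s i≤d))) h<i)))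
    window : ∀ i → rowT i ξ ≈ Σ< s (λ l → A i (t +ₙ l) * ξ (t +ₙ l))
    window i = Σ<-window t s (suc d) (λ j → A i j * ξ j) fits (λ j j<t → *≈0ʳ _ (ξ-below j j<t))
                 (λ j t+s≤j → *≈0ʳ _ (ξ-above j (≡.subst (_≤ j) t+s≡1+h t+s≤j)))
    block-zero : ∀ l → l < s → ξ (t +ₙ l) ≈ 0#
    block-zero = block-kernel s t (λ l → ξ (t +ₙ l)) fits (λ i i<s →
      trans (sym (window i)) (trans (sym (row-ℕ i (ℕP.<-≤-trans i<s (ℕP.m≤n⇒m≤1+n s≤d))))
        (InU'-below s≤d x∈U' _ (≡.subst (_< s) (≡.sym (FinP.toℕ-fromℕ< _)) i<s))))

  coord : ∀ i → i ≤ d → Fin (suc d)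
  coord i i≤d = fromℕ< (s≤s i≤d)

  InU-extend : ∀ {i} {u : Vec d} (i<d : i < d) → InU (suc i) u → u (coord (suc i) i<d) ≈ 0# → InU i u
  InU-extend {i} {u} i<d u∈U ui≈0 k i<k with suc i <? toℕ k
  ... | yes i+1<k = u∈U k i+1<k
  ... | no  i+1≮k = ≡.subst (λ k' → u k' ≈ 0#) (≡.sym k≡i+1) ui≈0
    where
    k≡i+1 : k ≡ coord (suc i) i<d
    k≡i+1 = FinP.toℕ-injective (≡.trans (ℕP.≤-antisym (ℕP.≮⇒≥ i+1≮k) i<k) (≡.sym (FinP.toℕ-fromℕ< (s≤s i<d))))

  InU'-extend : ∀ {s} {u : Vec d} (s<d : s < d) → InU' (d ∸ s) u → u (coord s (ℕP.<⇒≤ s<d)) ≈ 0# → InU' (d ∸ suc s) u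
  InU'-extend {s} {u} s<d u∈U' us≈0 k k< with toℕ k <? s
  ... | yes k<s = u∈U' k (≡.subst (toℕ k <_) (≡.sym (ℕP.m∸[m∸n]≡n (ℕP.<⇒≤ s<d))) k<s)
  ... | no  k≮s = ≡.subst (λ k' → u k' ≈ 0#) (≡.sym k≡s) us≈0
    where
    k≡s : k ≡ coord s (ℕP.<⇒≤ s<d)
    k≡s = FinP.toℕ-injective (≡.trans (ℕP.≤-antisym (ℕP.≤-pred (≡.subst (toℕ k <_) (ℕP.m∸[m∸n]≡n s<d) k<)) (ℕP.≮⇒≥ k≮s))
                                      (≡.sym (FinP.toℕ-fromℕ< (s≤s (ℕP.<⇒≤ s<d)))))

  canonical-at-s≉0 : ∀ r s t (sum : r +ₙ s +ₙ t ≡ d) →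
                     ¬ (canonical s t (coord s (Coordinates.s≤n {r} {s} {t} sum)) ≈ 0#)
  canonical-at-s≉0 r s t sum vs≈0 = D-nonzero (suc s) t window≤ (cancelˡ (sgn s) _ (sgn≉0 s)
      (trans (sym (canonical-pivot s t _ window≤ (FinP.toℕ-fromℕ< (s≤s s≤n)))) vs≈0))
    where
    open Coordinates {r} {s} {t} sum
    sgn≉0 : ∀ k → ¬ (sgn k ≈ 0#)
    sgn≉0 k sk≈0 = 1≉0 (trans (sym (sgn-sq k)) (*≈0ʳ _ sk≈0))

  canonical-nonzero : ∀ r s t → r +ₙ s +ₙ t ≡ d → NonZero (canonical s t)
  canonical-nonzero r s t sum v≈0 = canonical-at-s≉0 r s t sum (v≈0 _)

  -- For λ = (r,s,t) ∈ △_d with s < d, B_λ is the line of its canonical vector v: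
  -- x - (x_s / v_s)·v ∈ B_λ has vanishing coordinate s, hence lies in
  -- B_{(r,s+1,t)}, which is 0.
  B-line : ∀ r s t → r +ₙ s +ₙ t ≡ d → s < d → ∀ x → InB T (r , s , t) x →
           Σ R (λ κ → x ≈V (κ ·V canonical s t))
  B-line r s t sum s<d x x∈B = κ , (λ k → difference≈0 (x k) κ (v k) (u≈0 k))
    where
    open Coordinates {r} {s} {t} sum
    v : Vec d
    v = canonical s t
    i : Fin (suc d)
    i = coord s (ℕP.<⇒≤ s<d)
    vi≉0 : ¬ (v i ≈ 0#)
    vi≉0 = canonical-at-s≉0 r s t sum
    κ : R
    κ = quot (x i) (v i) vi≉0
    u : Vec d
    u = x +V ((- κ) ·V v)
    u∈B : InB T (r , s , t) u
    u∈B = InB-combine (r , s , t) (- κ) x∈B (canonical-∈B r s t sum)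
    ui≈0 : u i ≈ 0#
    ui≈0 = trans (+-congˡ (trans (neg-*ˡ _ _) (-‿cong (quot-* (x i) (v i) vi≉0)))) (-‿inverseʳ _)
    u∈B' : InB T (r , suc s , t) u
    u∈B' = proj₁ u∈B , InU'-extend s<d (proj₁ (proj₂ u∈B)) ui≈0 , proj₂ (proj₂ u∈B)
    u≈0 : u ≈V 0V
    u≈0 = B-vanishes r (suc s) t (≡.trans (cong (_+ₙ t) (ℕP.+-suc r s)) (cong suc sum)) r≤n s<d t≤n u u∈B'

  -- det T[λ] for λ = (a,b,c) ∈ △_d is D(b+1,c), as T[λ] = T[c, c+b].
  detT-block⁺ : ∀ a b c → a +ₙ b +ₙ c ≡ d → detT T (ℤ.+ a , ℤ.+ b , ℤ.+ c) ≡ D (suc b) c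
  detT-block⁺ a b c sum with ℤ.0ℤ ℤ.≤? ℤ.+ a | ℤ.0ℤ ℤ.≤? ℤ.+ b | ℤ.0ℤ ℤ.≤? ℤ.+ c | ℤ.+ a ℤ.+ ℤ.+ b ℤ.+ ℤ.+ c ℤ.≟ ℤ.+ d
  ... | yes _   | yes _   | yes _   | yes _  = cong (λ n → D (suc n) c)
                                                (≡.trans (cong (_∸ c) (Coordinates.n∸r {a} {b} {c} sum)) (ℕP.m+n∸m≡n c b))
  ... | no 0≰a  | _       | _       | _      = ⊥-elim (0≰a (ℤ.+≤+ z≤n))
  ... | yes _   | no 0≰b  | _       | _      = ⊥-elim (0≰b (ℤ.+≤+ z≤n))
  ... | yes _   | yes _   | no 0≰c  | _      = ⊥-elim (0≰c (ℤ.+≤+ z≤n))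
  ... | yes _   | yes _   | yes _   | no ≢d  = ⊥-elim (≢d (cong ℤ.+_ sum))

  -- A location with second coordinate -1 lies outside △_d, so det T[λ] = det ∅ = 1.
  detT-outside : ∀ a c → detT T (ℤ.+ a , ℤ.-[1+ 0 ] , ℤ.+ c) ≡ 1#
  detT-outside a c with ℤ.0ℤ ℤ.≤? ℤ.+ a | ℤ.0ℤ ℤ.≤? ℤ.-[1+ 0 ] | ℤ.0ℤ ℤ.≤? ℤ.+ c | ℤ.+ a ℤ.+ ℤ.-[1+ 0 ] ℤ.+ ℤ.+ c ℤ.≟ ℤ.+ d
  ... | _     | no _   | _ | _ = ≡.refl
  ... | yes _ | yes () | _ | _
  ... | no _  | yes _  | _ | _ = ≡.refl

  detT-block : ∀ a b c → a +ₙ b +ₙ c ≡ suc d → detT T (ℤ.+ a , ℤ.+ b ℤ.+ ℤ.-[1+ 0 ] , ℤ.+ c) ≈ D b c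
  detT-block a zero    c _   = reflexive (detT-outside a c)
  detT-block a (suc b) c sum = reflexive (detT-block⁺ a b c (ℕP.suc-injective (≡.trans (cong (_+ₙ c) (≡.sym (ℕP.+-suc a b))) sum)))

  detT-nonzero : ∀ a b c → a +ₙ b +ₙ c ≡ suc d → ¬ (detT T (ℤ.+ a , ℤ.+ b ℤ.+ ℤ.-[1+ 0 ] , ℤ.+ c) ≈ 0#)
  detT-nonzero a b c sum detT≈0 = D-nonzero b c fits (trans (sym (detT-block a b c sum)) detT≈0)
    where
    fits : c +ₙ b ≤ suc d
    fits = ≡.subst (_≤ suc d) (Coordinates.n∸r {a} {b} {c} sum) (ℕP.m∸n≤m (suc d) a)

  scale-nonzero : ∀ {a} {v : Vec d} → ¬ (a ≈ 0#) → NonZero v → NonZero (a ·V v)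
  scale-nonzero a≉0 v≉0 av≈0 = v≉0 (λ k → cancelˡ _ _ a≉0 (av≈0 k))

  -- An edge from → to of a black 3-clique, with third vertex ν, described by
  -- nonzero P ∈ B_from, Q ∈ B_to and κ ≠ 0 with P + κQ ∈ B_ν, where moreover
  -- B_to ∩ B_ν = 0.  Then B̃_{from,to} is multiplication by κ in the
  -- coordinates given by P and Q.
  record Edge (from to : NLoc) : Set (c ⊔ ℓ) where
    field
      P Q       : Vec d
      κ         : R
      κ≉0       : ¬ (κ ≈ 0#)
      P≉0       : NonZero P
      Q≉0       : NonZero Q
      P∈B       : InB T from P
      Q∈B       : InB T to Q
      P+κQ∈B    : InB T (blackThird from to) (P +V (κ ·V Q))
      meet-zero : ∀ u → InB T to u → InB T (blackThird from to) u → u ≈V 0V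

  module _ {from to : NLoc} (e : Edge from to) where
    open Edge e

    -- B̃_{from,to} sends a·P to aκ·Q ...
    edge-maps : ∀ a → ¬ (a ≈ 0#) → Btilde T from to (a ·V P) ((a * κ) ·V Q)
    edge-maps a a≉0 =
      InB-scale from a P∈B , scale-nonzero a≉0 P≉0 , InB-scale to (a * κ) Q∈B , scale-nonzero (*-nonzero a≉0 κ≉0) Q≉0 ,
      InB-cong (blackThird from to) (λ k → trans (distribˡ _ _ _) (+-congˡ (sym (*-assoc _ _ _))))
               (InB-scale (blackThird from to) a P+κQ∈B)

    -- ... and nothing else: y - aκ·Q lies in B_to and, as x + y and
    -- a(P + κQ) lie in B_ν, also in B_ν.
    edge-determined : ∀ a x y → x ≈V (a ·V P) → Btilde T from to x y → y ≈V ((a * κ) ·V Q)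
    edge-determined a x y x≈aP (_ , _ , y∈B , _ , x+y∈B) k = difference≈0 _ _ _ (meet-zero u u∈B-to u∈B-ν k)
      where
      u : Vec d
      u = y +V ((- (a * κ)) ·V Q)
      u∈B-to : InB T to u
      u∈B-to = InB-combine to (- (a * κ)) y∈B Q∈B
      u∈B-ν : InB T (blackThird from to) u
      u∈B-ν = InB-cong (blackThird from to) (λ k → shift-combination a (P k) (y k) κ (Q k) (x k) (x≈aP k))
                       (InB-combine (blackThird from to) (- a) x+y∈B P+κQ∈B)

-- The white 3-clique of τ = (r,s,t) in △_d, d = r+s+t+2, μ = (r+1,s,t+1).
-- Its vertices μ-α, μ, μ+β carry the canonical vectors p, q, w, and its
-- edges are Edges with ratios
--   κ₁ = -det T[μ+γ] / det T[μ-β],  κ₂ = det T[μ+α] / det T[μ-γ],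
--   κ₃ = -det T[μ+β] / det T[μ-α],
-- each forced by the one coordinate in which P + κQ must vanish to drop into
-- the smaller flag subspace at the third vertex.  The B-value is κ₁κ₂κ₃.
module WhiteClique {c ℓ} (F : Field c ℓ) (r s t : ℕ)
                   (T : WithField.Mat F (r +ₙ s +ₙ t +ₙ 2)) (vg : WithField.VeryGood F T) where
  open Field F hiding (zero)
  open WithField F
  open FieldFacts F
  open BilliardArray F (r +ₙ s +ₙ t +ₙ 2) T vg
  open CliqueArithmetic r s t
  open import Relation.Binary.Reasoning.Setoid setoid
  open import Algebra.Properties.Ring ring using (-‿involutive)
  open import Algebra.Solver.Ring.NaturalCoefficients.Default commutativeSemiring using (solve; _:=_; _:*_)

  d : ℕ
  d = r +ₙ s +ₙ t +ₙ 2

  μ : Loc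
  μ = (ℤ.+ suc r , ℤ.+ s , ℤ.+ suc t)

  D[μ+α] D[μ+β] D[μ+γ] D[μ-α] D[μ-β] D[μ-γ] : R
  D[μ+α] = detT T (μ +L α)
  D[μ+β] = detT T (μ +L β)
  D[μ+γ] = detT T (μ +L γ)
  D[μ-α] = detT T (μ -L α)
  D[μ-β] = detT T (μ -L β)
  D[μ-γ] = detT T (μ -L γ)

  D[μ+α]-block : D[μ+α] ≈ D s (suc t)
  D[μ+α]-block = trans (detT-block (suc r +ₙ 1) s (suc t +ₙ 0) sum[μ+α]) (reflexive (cong (D s) (ℕP.+-identityʳ (suc t))))
  D[μ+β]-block : D[μ+β] ≈ D (suc (suc s)) t
  D[μ+β]-block = trans (detT-block (suc r +ₙ 0) (suc (s +ₙ 1)) t sum[μ+β]) (reflexive (cong (λ b → D (suc b) t) (ℕP.+-comm s 1)))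
  D[μ+γ]-block : D[μ+γ] ≈ D (suc s) (suc (suc t))
  D[μ+γ]-block = trans (detT-block r (suc (s +ₙ 0)) (suc t +ₙ 1) sum[μ+γ])
                       (reflexive (cong₂ (λ b c → D (suc b) c) (ℕP.+-identityʳ s) (ℕP.+-comm (suc t) 1)))
  D[μ-α]-block : D[μ-α] ≈ D (suc (suc s)) (suc t)
  D[μ-α]-block = trans (detT-block r (suc (s +ₙ 1)) (suc t +ₙ 0) sum[μ-α])
                       (reflexive (cong₂ (λ b c → D (suc b) c) (ℕP.+-comm s 1) (ℕP.+-identityʳ (suc t))))
  D[μ-β]-block : D[μ-β] ≈ D s (suc (suc t))
  D[μ-β]-block = trans (detT-block (suc r +ₙ 0) s (suc t +ₙ 1) sum[μ-β]) (reflexive (cong (D s) (ℕP.+-comm (suc t) 1)))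
  D[μ-γ]-block : D[μ-γ] ≈ D (suc s) t
  D[μ-γ]-block = trans (detT-block (suc r +ₙ 1) (suc (s +ₙ 0)) t sum[μ-γ]) (reflexive (cong (λ b → D (suc b) t) (ℕP.+-identityʳ s)))

  D[μ+α]≉0 : ¬ (D[μ+α] ≈ 0#)
  D[μ+α]≉0 = detT-nonzero (suc r +ₙ 1) s (suc t +ₙ 0) sum[μ+α]
  D[μ+β]≉0 : ¬ (D[μ+β] ≈ 0#)
  D[μ+β]≉0 = detT-nonzero (suc r +ₙ 0) (suc (s +ₙ 1)) t sum[μ+β]
  D[μ+γ]≉0 : ¬ (D[μ+γ] ≈ 0#)
  D[μ+γ]≉0 = detT-nonzero r (suc (s +ₙ 0)) (suc t +ₙ 1) sum[μ+γ]
  D[μ-α]≉0 : ¬ (D[μ-α] ≈ 0#)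
  D[μ-α]≉0 = detT-nonzero r (suc (s +ₙ 1)) (suc t +ₙ 0) sum[μ-α]
  D[μ-β]≉0 : ¬ (D[μ-β] ≈ 0#)
  D[μ-β]≉0 = detT-nonzero (suc r +ₙ 0) s (suc t +ₙ 1) sum[μ-β]
  D[μ-γ]≉0 : ¬ (D[μ-γ] ≈ 0#)
  D[μ-γ]≉0 = detT-nonzero (suc r +ₙ 1) (suc (s +ₙ 0)) t sum[μ-γ]

  p q w : Vec d
  p = canonical (suc s) (suc t)
  q = canonical s (suc t)
  w = canonical (suc s) t

  p∈B : InB T (r , suc s , suc t) p
  p∈B = canonical-∈B r (suc s) (suc t) in△[μ-α]
  q∈B : InB T (suc r , s , suc t) q
  q∈B = canonical-∈B (suc r) s (suc t) in△[μ]
  w∈B : InB T (suc r , suc s , t) w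
  w∈B = canonical-∈B (suc r) (suc s) t in△[μ+β]

  shrink : ∀ n → d ∸ suc n ≤ d ∸ n
  shrink n = ℕP.∸-monoʳ-≤ d (ℕP.n≤1+n n)

  κ₁ κ₂ κ₃ : R
  κ₁ = - quot D[μ+γ] D[μ-β] D[μ-β]≉0
  κ₂ = quot D[μ+α] D[μ-γ] D[μ-γ]≉0
  κ₃ = - quot D[μ+β] D[μ-α] D[μ-α]≉0

  -- Edge μ-α → μ, third vertex (r,s,t+2): the coefficients of p and q start
  -- at column t+1 with D(s+1,t+2) = det T[μ+γ] and D(s,t+2) = det T[μ-β].
  p+κ₁q∈B : InB T (r , s , suc (suc t)) (p +V (κ₁ ·V q))
  p+κ₁q∈B = InU-combine (d ∸ r) κ₁ (proj₁ p∈B) (InU-mono (shrink r) (proj₁ q∈B)) ,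
            InU'-combine (d ∸ s) κ₁ (InU'-mono (shrink s) (proj₁ (proj₂ p∈B))) (proj₁ (proj₂ q∈B)) ,
            canonical-combine-U'' (suc s) s (suc t) κ₁ (Coordinates.t≤n {r} {s} {suc (suc t)} in△[ν₁]) first-coeffs
    where
    first-coeffs : coeffs (suc s) (suc t) (suc t) + κ₁ * coeffs s (suc t) (suc t) ≈ 0#
    first-coeffs = begin
      coeffs (suc s) (suc t) (suc t) + κ₁ * coeffs s (suc t) (suc t)
        ≈⟨ +-cong (trans (coeffs-first (suc s) (suc t)) (trans (sym D[μ+γ]-block) (sym (*-identityˡ _))))
                  (*-congˡ (trans (coeffs-first s (suc t)) (trans (sym D[μ-β]-block) (sym (*-identityˡ _))))) ⟩
      1# * D[μ+γ] + κ₁ * (1# * D[μ-β])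
        ≈⟨ ratio-cancel 1# D[μ+γ] D[μ-β] D[μ-β]≉0 ⟩
      0# ∎

  -- Edge μ → μ+β, third vertex (r+2,s,t): at the coordinate h = t+s+1 = d-r-1,
  -- q and w are ±A_hh·D(s,t+1) = ±A_hh·det T[μ+α] and ∓A_hh·D(s+1,t) = ∓A_hh·det T[μ-γ].
  q+κ₂w∈B : InB T (suc (suc r) , s , t) (q +V (κ₂ ·V w))
  q+κ₂w∈B = ≡.subst (λ i → InU i (q +V (κ₂ ·V w))) (≡.sym (Coordinates.n∸r {suc (suc r)} {s} {t} in△[ν₂]))
                    (InU-extend h<d (≡.subst (λ i → InU i (q +V (κ₂ ·V w))) (Coordinates.n∸r {suc r} {s} {suc t} in△[μ])
                                       (InU-combine (d ∸ suc r) κ₂ (proj₁ q∈B) (proj₁ w∈B)))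
                                last-coordinate) ,
            InU'-combine (d ∸ s) κ₂ (proj₁ (proj₂ q∈B)) (InU'-mono (shrink s) (proj₁ (proj₂ w∈B))) ,
            InU''-combine (d ∸ t) κ₂ (InU''-mono (shrink t) (proj₂ (proj₂ q∈B))) (proj₂ (proj₂ w∈B))
    where
    h<d : t +ₙ s < d
    h<d = ≡.subst (_≤ d) (Coordinates.n∸r {suc r} {s} {suc t} in△[μ]) (ℕP.m∸n≤m d (suc r))
    h : Fin (suc d)
    h = coord (suc (t +ₙ s)) h<d
    h≡ : toℕ h ≡ suc (t +ₙ s)
    h≡ = FinP.toℕ-fromℕ< (s≤s h<d)
    m : R
    m = sgn s * A (toℕ h) (toℕ h)
    q-at-h : q h ≈ m * D[μ+α]
    q-at-h = trans (canonical-corner s (suc t) h (Coordinates.window≤ {suc r} {s} {suc t} in△[μ]) h≡)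
                   (trans (sym (*-assoc _ _ _)) (*-congˡ (sym D[μ+α]-block)))
    w-at-h : κ₂ * w h ≈ (- κ₂) * (m * D[μ-γ])
    w-at-h = trans (*-congˡ (canonical-corner (suc s) t h (Coordinates.window≤ {suc r} {suc s} {t} in△[μ+β])
                                              (≡.trans h≡ (≡.sym (ℕP.+-suc t s)))))
                   (trans (neg-swap κ₂ (sgn s) _) (*-congˡ (trans (sym (*-assoc _ _ _)) (*-congˡ (sym D[μ-γ]-block)))))
    last-coordinate : (q +V (κ₂ ·V w)) h ≈ 0#
    last-coordinate = trans (+-cong q-at-h w-at-h) (ratio-cancel m D[μ+α] D[μ-γ] D[μ-γ]≉0)

  -- Edge μ+β → μ-α, third vertex (r,s+2,t): at the coordinate s+1, w and p
  -- are ±D(s+2,t) = ±det T[μ+β] and ±D(s+2,t+1) = ±det T[μ-α].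
  s+1<d : suc s < d
  s+1<d = Coordinates.s≤n {r} {suc (suc s)} {t} in△[ν₃]

  w+κ₃p∈B : InB T (r , suc (suc s) , t) (w +V (κ₃ ·V p))
  w+κ₃p∈B = InU-combine (d ∸ r) κ₃ (InU-mono (shrink r) (proj₁ w∈B)) (proj₁ p∈B) ,
            InU'-extend s+1<d (InU'-combine (d ∸ suc s) κ₃ (proj₁ (proj₂ w∈B)) (proj₁ (proj₂ p∈B))) pivot-coordinate ,
            InU''-combine (d ∸ t) κ₃ (proj₂ (proj₂ w∈B)) (InU''-mono (shrink t) (proj₂ (proj₂ p∈B)))
    where
    k : Fin (suc d)
    k = coord (suc s) (ℕP.<⇒≤ s+1<d)
    k≡ : toℕ k ≡ suc s
    k≡ = FinP.toℕ-fromℕ< (s≤s (ℕP.<⇒≤ s+1<d))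
    w-at-k : w k ≈ sgn (suc s) * D[μ+β]
    w-at-k = trans (canonical-pivot (suc s) t k (Coordinates.window≤ {suc r} {suc s} {t} in△[μ+β]) k≡) (*-congˡ (sym D[μ+β]-block))
    p-at-k : p k ≈ sgn (suc s) * D[μ-α]
    p-at-k = trans (canonical-pivot (suc s) (suc t) k (Coordinates.window≤ {r} {suc s} {suc t} in△[μ-α]) k≡) (*-congˡ (sym D[μ-α]-block))
    pivot-coordinate : (w +V (κ₃ ·V p)) k ≈ 0#
    pivot-coordinate = trans (+-cong w-at-k (*-congˡ p-at-k)) (ratio-cancel (sgn (suc s)) D[μ+β] D[μ-α] D[μ-α]≉0)

  -- The three edges.  B_to ∩ B_ν is contained in B of a location with
  -- coordinate sum d+1 (take each flag condition from the stronger side),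
  -- hence vanishes.
  edge₁ : Edge (r , suc s , suc t) (suc r , s , suc t)
  edge₁ = record
    { P = p ; Q = q ; κ = κ₁
    ; κ≉0 = neg-nonzero (quot-nonzero D[μ-β]≉0 D[μ+γ]≉0)
    ; P≉0 = canonical-nonzero r (suc s) (suc t) in△[μ-α]
    ; Q≉0 = canonical-nonzero (suc r) s (suc t) in△[μ]
    ; P∈B = p∈B
    ; Q∈B = q∈B
    ; P+κQ∈B = ≡.subst (λ loc → InB T loc (p +V (κ₁ ·V q))) (≡.sym (third[μ-α,μ] r s t)) p+κ₁q∈B
    ; meet-zero = λ u u∈B u∈B' → let u∈Bν = ≡.subst (λ loc → InB T loc u) (third[μ-α,μ] r s t) u∈B' in
        B-vanishes (suc r) s (suc (suc t)) sum[meet₁] (Coordinates.r≤n {suc r} {s} {suc t} in△[μ])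
                   (Coordinates.s≤n {suc r} {s} {suc t} in△[μ]) (Coordinates.t≤n {r} {s} {suc (suc t)} in△[ν₁])
                   u (proj₁ u∈B , proj₁ (proj₂ u∈B) , proj₂ (proj₂ u∈Bν))
    }

  edge₂ : Edge (suc r , s , suc t) (suc r , suc s , t)
  edge₂ = record
    { P = q ; Q = w ; κ = κ₂
    ; κ≉0 = quot-nonzero D[μ-γ]≉0 D[μ+α]≉0
    ; P≉0 = canonical-nonzero (suc r) s (suc t) in△[μ]
    ; Q≉0 = canonical-nonzero (suc r) (suc s) t in△[μ+β]
    ; P∈B = q∈B
    ; Q∈B = w∈B
    ; P+κQ∈B = ≡.subst (λ loc → InB T loc (q +V (κ₂ ·V w))) (≡.sym (third[μ,μ+β] r s t)) q+κ₂w∈B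
    ; meet-zero = λ u u∈B u∈B' → let u∈Bν = ≡.subst (λ loc → InB T loc u) (third[μ,μ+β] r s t) u∈B' in
        B-vanishes (suc (suc r)) (suc s) t sum[meet₂] (Coordinates.r≤n {suc (suc r)} {s} {t} in△[ν₂])
                   (Coordinates.s≤n {suc r} {suc s} {t} in△[μ+β]) (Coordinates.t≤n {suc r} {suc s} {t} in△[μ+β])
                   u (proj₁ u∈Bν , proj₁ (proj₂ u∈B) , proj₂ (proj₂ u∈B))
    }

  edge₃ : Edge (suc r , suc s , t) (r , suc s , suc t)
  edge₃ = record
    { P = w ; Q = p ; κ = κ₃
    ; κ≉0 = neg-nonzero (quot-nonzero D[μ-α]≉0 D[μ+β]≉0)
    ; P≉0 = canonical-nonzero (suc r) (suc s) t in△[μ+β]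
    ; Q≉0 = canonical-nonzero r (suc s) (suc t) in△[μ-α]
    ; P∈B = w∈B
    ; Q∈B = p∈B
    ; P+κQ∈B = ≡.subst (λ loc → InB T loc (w +V (κ₃ ·V p))) (≡.sym (third[μ+β,μ-α] r s t)) w+κ₃p∈B
    ; meet-zero = λ u u∈B u∈B' → let u∈Bν = ≡.subst (λ loc → InB T loc u) (third[μ+β,μ-α] r s t) u∈B' in
        B-vanishes r (suc (suc s)) (suc t) sum[meet₃] (Coordinates.r≤n {r} {suc s} {suc t} in△[μ-α])
                   (Coordinates.s≤n {r} {suc (suc s)} {t} in△[ν₃]) (Coordinates.t≤n {r} {suc s} {suc t} in△[μ-α])
                   u (proj₁ u∈B , proj₁ (proj₂ u∈Bν) , proj₂ (proj₂ u∈B))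
    }

  κ : R
  κ = (κ₁ * κ₂) * κ₃

  num den : R
  num = D[μ+α] * (D[μ+β] * D[μ+γ])
  den = D[μ-α] * (D[μ-β] * D[μ-γ])

  den≉0 : ¬ (den ≈ 0#)
  den≉0 = *-nonzero D[μ-α]≉0 (*-nonzero D[μ-β]≉0 D[μ-γ]≉0)

  κ-quotient : κ * den ≈ num
  κ-quotient = begin
    ((κ₁ * κ₂) * κ₃) * den                 ≈⟨ *-congʳ (trans (neg-*ʳ _ _) (trans (-‿cong (*-congʳ (neg-*ˡ _ _)))
                                                 (trans (-‿cong (neg-*ˡ _ _)) (-‿involutive _)))) ⟩
    ((x₁ * x₂) * x₃) * den                 ≈⟨ regroup D[μ+γ] i₁ D[μ+α] i₂ D[μ+β] i₃ D[μ-α] D[μ-β] D[μ-γ] ⟩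
    num * ((D[μ-β] * i₁) * ((D[μ-γ] * i₂) * (D[μ-α] * i₃)))
                                           ≈⟨ *-congˡ (trans (*-cong (inv-r _ D[μ-β]≉0) (*-cong (inv-r _ D[μ-γ]≉0) (inv-r _ D[μ-α]≉0)))
                                                             (trans (*-identityˡ _) (*-identityˡ _))) ⟩
    num * 1#                               ≈⟨ *-identityʳ num ⟩
    num                                    ∎
    where
    i₁ i₂ i₃ x₁ x₂ x₃ : R
    i₁ = inv D[μ-β] D[μ-β]≉0
    i₂ = inv D[μ-γ] D[μ-γ]≉0
    i₃ = inv D[μ-α] D[μ-α]≉0
    x₁ = D[μ+γ] * i₁
    x₂ = D[μ+α] * i₂
    x₃ = D[μ+β] * i₃
    regroup : ∀ a₁ i₁ a₂ i₂ a₃ i₃ b₃ b₁ b₂ →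
              (((a₁ * i₁) * (a₂ * i₂)) * (a₃ * i₃)) * (b₃ * (b₁ * b₂)) ≈ (a₂ * (a₃ * a₁)) * ((b₁ * i₁) * ((b₂ * i₂) * (b₃ * i₃)))
    regroup = solve 9 (λ a₁ i₁ a₂ i₂ a₃ i₃ b₃ b₁ b₂ →
      ((((a₁ :* i₁) :* (a₂ :* i₂)) :* (a₃ :* i₃)) :* (b₃ :* (b₁ :* b₂))) :=
      ((a₂ :* (a₃ :* a₁)) :* ((b₁ :* i₁) :* ((b₂ :* i₂) :* (b₃ :* i₃))))) refl

  -- Following p around the clique: p ↦ κ₁q ↦ κ₁κ₂w ↦ κ₁κ₂κ₃p, so a
  -- B-value must be κ.
  B-value-is-κ : ∀ c₀ → IsBValue T r s t c₀ → κ ≈ c₀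
  B-value-is-κ c₀ isB = cancelʳ κ c₀ (p i) (canonical-at-s≉0 r (suc s) (suc t) in△[μ-α]) (begin
    ((κ₁ * κ₂) * κ₃) * p i                 ≈⟨ *-congʳ (*-congʳ (*-congʳ (sym (*-identityˡ κ₁)))) ⟩
    (a₂ * κ₃) * p i                        ≈⟨ around i ⟩
    c₀ * (1# * p i)                        ≈⟨ *-congˡ (*-identityˡ _) ⟩
    c₀ * p i                               ∎)
    where
    i : Fin (suc d)
    i = coord (suc s) (Coordinates.s≤n {r} {suc s} {suc t} in△[μ-α])
    a₁ a₂ : R
    a₁ = 1# * κ₁
    a₂ = a₁ * κ₂
    a₁≉0 : ¬ (a₁ ≈ 0#)
    a₁≉0 = *-nonzero 1≉0 (Edge.κ≉0 edge₁)
    around : ((a₂ * κ₃) ·V p) ≈V (c₀ ·V (1# ·V p))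
    around = isB (1# ·V p) (a₁ ·V q) (a₂ ·V w) ((a₂ * κ₃) ·V p)
                 (edge-maps edge₁ 1# 1≉0) (edge-maps edge₂ a₁ a₁≉0) (edge-maps edge₃ a₂ (*-nonzero a₁≉0 (Edge.κ≉0 edge₂)))

  -- Conversely every x ∈ B_{μ-α} is a multiple a·p, and the edges carry it
  -- around to aκ·p = κ·x.
  κ-is-B-value : ∀ c₀ → κ ≈ c₀ → IsBValue T r s t c₀
  κ-is-B-value c₀ κ≈c₀ x y z x' x↦y y↦z z↦x' k = begin
    x' k                                   ≈⟨ x'≈ k ⟩
    (((a * κ₁) * κ₂) * κ₃) * p k           ≈⟨ reorder a κ₁ κ₂ κ₃ (p k) ⟩
    κ * (a * p k)                          ≈⟨ *-cong κ≈c₀ (sym (x≈ap k)) ⟩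
    c₀ * x k                               ∎
    where
    line : Σ R (λ a → x ≈V (a ·V p))
    line = B-line r (suc s) (suc t) in△[μ-α] s+1<d x (proj₁ x↦y)
    a : R
    a = proj₁ line
    x≈ap : x ≈V (a ·V p)
    x≈ap = proj₂ line
    y≈ : y ≈V ((a * κ₁) ·V q)
    y≈ = edge-determined edge₁ a x y x≈ap x↦y
    z≈ : z ≈V (((a * κ₁) * κ₂) ·V w)
    z≈ = edge-determined edge₂ (a * κ₁) y z y≈ y↦z
    x'≈ : x' ≈V ((((a * κ₁) * κ₂) * κ₃) ·V p)
    x'≈ = edge-determined edge₃ ((a * κ₁) * κ₂) z x' z≈ z↦x'
    reorder : ∀ a k₁ k₂ k₃ v → (((a * k₁) * k₂) * k₃) * v ≈ ((k₁ * k₂) * k₃) * (a * v)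
    reorder = solve 5 (λ a k₁ k₂ k₃ v → ((((a :* k₁) :* k₂) :* k₃) :* v) := (((k₁ :* k₂) :* k₃) :* (a :* v))) refl

  B-value : ¬ (den ≈ 0#) × (∀ c₀ → IsBValue T r s t c₀ ⇔ (c₀ * den ≈ num))
  B-value = den≉0 , λ c₀ → mk⇔
    (λ isB → trans (*-congʳ (sym (B-value-is-κ c₀ isB))) κ-quotient)
    (λ c₀den≈num → κ-is-B-value c₀ (cancelʳ κ c₀ den den≉0 (trans κ-quotient (sym c₀den≈num))))

open import Data.Nat using (_+_)
open import Data.Integer using (+_)

theorem6p6 : ∀ {c ℓ} (F : Field c ℓ) (d r s t : ℕ) → r + s + t + 2 ≡ d →
    let open Field F
        open WithField F
    in
    (T : Mat d) → VeryGood T →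
    let μ   = (+ suc r , + s , + suc t)
        num = detT T (μ +L α) * (detT T (μ +L β) * detT T (μ +L γ))
        den = detT T (μ -L α) * (detT T (μ -L β) * detT T (μ -L γ))
    in ¬ (den ≈ 0#) × (∀ (c₀ : Carrier) → IsBValue T r s t c₀ ⇔ (c₀ * den ≈ num))
theorem6p6 F .(r + s + t + 2) r s t ≡.refl T vg = WhiteClique.B-value F r s t T vg
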